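{- As formal power series in $z,t$, $$\sum_{m\ge0}\sum_{k\ge0}T_{12\times m}(6,k)z^mt^k=\frac{N(z,t)}{D(z,t)},$$ where $$N(z,t)=1-z^3t-z^4t-z^5t-2z^6t^2-z^7t^2+2z^9t^3+2z^{10}t^3+z^{12}t^4-z^{15}t^5,$$ $$\begin{aligned}D(z,t)={}&1-z-z^3t-6z^6t-3z^6t^2-z^7t^2-z^8t^2+5z^9t^2+3z^9t^3+5z^{10}t^2+3z^{10}t^3\\&+5z^{11}t^2+3z^{11}t^3+10z^{12}t^3+3z^{12}t^4+5z^{13}t^3+2z^{13}t^4-10z^{15}t^4-3z^{15}t^5\\&-10z^{16}t^4-3z^{16}t^5-5z^{18}t^5-z^{18}t^6+5z^{21}t^6+z^{21}t^7.\end{aligned}$$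
   Context: $T_{n\times m}(s,k)$ denotes the number of tilings of an $n\times m$ rectangle (width $n$, length $m$, unit grid) by exactly $k$ non-overlapping grid-aligned $s\times s$ squares and $nm-ks^2$ unit squares, with rotations/reflections counted as distinct; for $m=0$ the only tiling is the empty one with $k=0$. -}

module Defs where

open import Data.Bool using (Bool; true; false; _∧_; _∨_; not)
open import Data.Nat using (ℕ; zero; suc; _+_; _∸_; _<ᵇ_; _≡ᵇ_)
open import Data.Integer as ℤ using (ℤ; +_; -[1+_])
open import Data.List using (List; []; _∷_; map; _++_; length; filter; upTo; cartesianProduct)
open import Data.Product using (_×_; _,_)
open import Relation.Nullary.Decidable using (Dec)
open import Relation.Binary.PropositionalEquality using (_≡_)
open import Data.Bool.Properties using (T?)
open import Data.Bool using (T)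

-- A tiling is determined by the set of positions of its s × s squares
-- (the remaining cells are covered by unit squares in exactly one way).
-- A placed s × s square is given by its lower-left corner (i , j) with
-- 0 ≤ i ≤ n - s (width direction) and 0 ≤ j ≤ m - s (length direction).

sublists : {A : Set} → List A → List (List A)
sublists []       = [] ∷ []
sublists (x ∷ xs) = let r = sublists xs in r ++ map (x ∷_) r

corners : ℕ → ℕ → List ℕ
corners s d with d <ᵇ s
... | true  = []
... | false = upTo (suc (d ∸ s))

positions : (n m s : ℕ) → List (ℕ × ℕ)
positions n m s = cartesianProduct (corners s n) (corners s m)

near : ℕ → ℕ → ℕ → Bool
near s a b = ((a ∸ b) <ᵇ s) ∧ ((b ∸ a) <ᵇ s)

overlaps : ℕ → ℕ × ℕ → ℕ × ℕ → Bool
overlaps s (i , j) (i' , j') = near s i i' ∧ near s j j'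

allB : {A : Set} → (A → Bool) → List A → Bool
allB p []       = true
allB p (x ∷ xs) = p x ∧ allB p xs

nonOverlapping : ℕ → List (ℕ × ℕ) → Bool
nonOverlapping s []       = true
nonOverlapping s (p ∷ ps) = allB (λ q → not (overlaps s p q)) ps ∧ nonOverlapping s ps

isTiling : (s k : ℕ) → List (ℕ × ℕ) → Bool
isTiling s k ps = (length ps ≡ᵇ k) ∧ nonOverlapping s ps

T-count : (n m s k : ℕ) → ℕ
T-count n m s k = length (filter (λ ps → T? (isTiling s k ps)) (sublists (positions n m s)))

-- Formal power series in z, t with integer coefficients:
-- a series is its coefficient function  (z-exponent) → (t-exponent) → ℤ.

PowerSeries : Set
PowerSeries = ℕ → ℕ → ℤ

sumTo : ℕ → (ℕ → ℤ) → ℤ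
sumTo zero    f = f zero
sumTo (suc n) f = sumTo n f ℤ.+ f (suc n)

_⊛_ : PowerSeries → PowerSeries → PowerSeries
(f ⊛ g) m k = sumTo m (λ i → sumTo k (λ j → f i j ℤ.* g (m ∸ i) (k ∸ j)))

-- a polynomial given as a list of monomials  c · z^a · t^b
Monomial : Set
Monomial = ℤ × ℕ × ℕ

poly : List Monomial → PowerSeries
poly []                   m k = + 0
poly ((c , a , b) ∷ ms)   m k with (a ≡ᵇ m) ∧ (b ≡ᵇ k)
... | true  = c ℤ.+ poly ms m k
... | false = poly ms m k

F₁₂ : PowerSeries
F₁₂ m k = + T-count 12 m 6 k

N : List Monomial
N = (+ 1 , 0 , 0) ∷ (-[1+ 0 ] , 3 , 1) ∷ (-[1+ 0 ] , 4 , 1) ∷ (-[1+ 0 ] , 5 , 1)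
  ∷ (-[1+ 1 ] , 6 , 2) ∷ (-[1+ 0 ] , 7 , 2) ∷ (+ 2 , 9 , 3) ∷ (+ 2 , 10 , 3)
  ∷ (+ 1 , 12 , 4) ∷ (-[1+ 0 ] , 15 , 5) ∷ []

D : List Monomial
D = (+ 1 , 0 , 0) ∷ (-[1+ 0 ] , 1 , 0) ∷ (-[1+ 0 ] , 3 , 1) ∷ (-[1+ 5 ] , 6 , 1)
  ∷ (-[1+ 2 ] , 6 , 2) ∷ (-[1+ 0 ] , 7 , 2) ∷ (-[1+ 0 ] , 8 , 2) ∷ (+ 5 , 9 , 2)
  ∷ (+ 3 , 9 , 3) ∷ (+ 5 , 10 , 2) ∷ (+ 3 , 10 , 3) ∷ (+ 5 , 11 , 2) ∷ (+ 3 , 11 , 3)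
  ∷ (+ 10 , 12 , 3) ∷ (+ 3 , 12 , 4) ∷ (+ 5 , 13 , 3) ∷ (+ 2 , 13 , 4)
  ∷ (-[1+ 9 ] , 15 , 4) ∷ (-[1+ 2 ] , 15 , 5) ∷ (-[1+ 9 ] , 16 , 4) ∷ (-[1+ 2 ] , 16 , 5)
  ∷ (-[1+ 4 ] , 18 , 5) ∷ (-[1+ 0 ] , 18 , 6) ∷ (+ 5 , 21 , 6) ∷ (+ 1 , 21 , 7) ∷ []

module Submission where

open import Defs
open import Data.Nat using (ℕ)
open import Data.Integer using (ℤ)
open import Relation.Binary.PropositionalEquality using (_≡_)

-- Cut the strip into its lower and upper six rows and count tilings of the more general
-- region in which the two halves may have different lengths.  Deciding whether the last
-- column of the longer half carries a 6 × 6 square (and in which row, when both halves are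
-- equally long) gives transfer recurrences between thirteen "profiles".  As generating
-- functions these become linear relations with polynomial coefficients, and an explicit
-- polynomial combination of them eliminates every profile but F, leaving D · F = N.  That the
-- combination is right is checked by normalising it as a formal linear combination.

module Counting where

  open import Data.Bool using (Bool; true; false; _∧_; not; if_then_else_)
  open import Data.Bool.Properties using (∧-comm; ∧-commutativeMonoid)
  open import Data.Nat using (zero; suc; _+_; _∸_; _<ᵇ_; _≡ᵇ_)
  open import Data.Nat.Properties using (+-comm; +-commutativeSemigroup)
  open import Data.List using (List; []; _∷_; _++_; map; filterᵇ; length)
  open import Data.List.Relation.Binary.Permutation.Propositional using (_↭_; refl; prep; swap; trans)
  open import Data.List.Relation.Binary.Permutation.Propositional.Properties using (↭-length)
  open import Data.Product using (_×_; _,_)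
  open import Function using (_∘_)
  open import Algebra.Bundles using (CommutativeMonoid)
  open import Algebra.Properties.CommutativeSemigroup +-commutativeSemigroup using ()
    renaming (interchange to +-interchange)
  open import Algebra.Properties.CommutativeSemigroup (CommutativeMonoid.commutativeSemigroup ∧-commutativeMonoid)
    using () renaming (interchange to ∧-interchange; x∙yz≈y∙xz to ∧-swapˡ)
  open import Relation.Binary.PropositionalEquality as ≡ using (cong; cong₂)
  open ≡.≡-Reasoning

  private variable
    A B : Set

  countᵇ : (A → Bool) → List A → ℕ
  countᵇ p []       = 0
  countᵇ p (x ∷ xs) = if p x then suc (countᵇ p xs) else countᵇ p xs

  length-filterᵇ : (p : A → Bool) (xs : List A) → length (filterᵇ p xs) ≡ countᵇ p xs
  length-filterᵇ p []       = ≡.refl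
  length-filterᵇ p (x ∷ xs) with p x
  ... | true  = cong suc (length-filterᵇ p xs)
  ... | false = length-filterᵇ p xs

  countᵇ-++ : (p : A → Bool) (xs ys : List A) → countᵇ p (xs ++ ys) ≡ countᵇ p xs + countᵇ p ys
  countᵇ-++ p []       ys = ≡.refl
  countᵇ-++ p (x ∷ xs) ys with p x
  ... | true  = cong suc (countᵇ-++ p xs ys)
  ... | false = countᵇ-++ p xs ys

  countᵇ-map : (p : B → Bool) (f : A → B) (xs : List A) → countᵇ p (map f xs) ≡ countᵇ (p ∘ f) xs
  countᵇ-map p f []       = ≡.refl
  countᵇ-map p f (x ∷ xs) with p (f x)
  ... | true  = cong suc (countᵇ-map p f xs)
  ... | false = countᵇ-map p f xs

  countᵇ-cong : {p q : A → Bool} → (∀ x → p x ≡ q x) → (xs : List A) → countᵇ p xs ≡ countᵇ q xs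
  countᵇ-cong p≗q []       = ≡.refl
  countᵇ-cong p≗q (x ∷ xs) rewrite p≗q x = cong (λ n → if _ then suc n else n) (countᵇ-cong p≗q xs)

  countᵇ-false : (xs : List A) → countᵇ (λ _ → false) xs ≡ 0
  countᵇ-false []       = ≡.refl
  countᵇ-false (x ∷ xs) = countᵇ-false xs

  countSublists : (List A → Bool) → List A → ℕ
  countSublists Q xs = countᵇ Q (sublists xs)

  countSublists-∷ : (Q : List A → Bool) (x : A) (xs : List A) →
    countSublists Q (x ∷ xs) ≡ countSublists Q xs + countSublists (Q ∘ (x ∷_)) xs
  countSublists-∷ Q x xs = ≡.trans (countᵇ-++ Q (sublists xs) _) (cong (_ +_) (countᵇ-map Q (x ∷_) (sublists xs)))

  countSublists-cong : {Q R : List A → Bool} → (∀ ys → Q ys ≡ R ys) → (xs : List A) →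
    countSublists Q xs ≡ countSublists R xs
  countSublists-cong Q≗R xs = countᵇ-cong Q≗R (sublists xs)

  countSublists-allB : (p : A → Bool) (Q : List A → Bool) (xs : List A) →
    countSublists (λ ys → allB p ys ∧ Q ys) xs ≡ countSublists Q (filterᵇ p xs)
  countSublists-allB p Q []       = ≡.refl
  countSublists-allB p Q (x ∷ xs) with p x in px
  ... | true  = begin
    countSublists (λ ys → allB p ys ∧ Q ys) (x ∷ xs)
      ≡⟨ countSublists-∷ _ x xs ⟩
    countSublists (λ ys → allB p ys ∧ Q ys) xs + countSublists (λ ys → (p x ∧ allB p ys) ∧ Q (x ∷ ys)) xs
      ≡⟨ cong₂ _+_ (countSublists-allB p Q xs)
           (≡.trans (countSublists-cong (λ ys → cong (λ b → (b ∧ allB p ys) ∧ Q (x ∷ ys)) px) xs)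
                    (countSublists-allB p (Q ∘ (x ∷_)) xs)) ⟩
    countSublists Q (filterᵇ p xs) + countSublists (Q ∘ (x ∷_)) (filterᵇ p xs)
      ≡⟨ countSublists-∷ Q x (filterᵇ p xs) ⟨
    countSublists Q (x ∷ filterᵇ p xs) ∎
  ... | false = begin
    countSublists (λ ys → allB p ys ∧ Q ys) (x ∷ xs)
      ≡⟨ countSublists-∷ _ x xs ⟩
    countSublists (λ ys → allB p ys ∧ Q ys) xs + countSublists (λ ys → (p x ∧ allB p ys) ∧ Q (x ∷ ys)) xs
      ≡⟨ cong₂ _+_ (countSublists-allB p Q xs)
           (≡.trans (countSublists-cong (λ ys → cong (λ b → (b ∧ allB p ys) ∧ Q (x ∷ ys)) px) xs)
                    (countᵇ-false (sublists xs))) ⟩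
    countSublists Q (filterᵇ p xs) + 0
      ≡⟨ +-comm _ 0 ⟩
    countSublists Q (filterᵇ p xs) ∎

  PermutationInvariant : (List A → Bool) → Set _
  PermutationInvariant Q = ∀ {xs ys} → xs ↭ ys → Q xs ≡ Q ys

  countSublists-↭ : {Q : List A → Bool} → PermutationInvariant Q → {xs ys : List A} → xs ↭ ys →
    countSublists Q xs ≡ countSublists Q ys
  countSublists-↭ Q-inv refl = ≡.refl
  countSublists-↭ {Q = Q} Q-inv (prep {xs} {ys} x xs↭ys) = begin
    countSublists Q (x ∷ xs)                            ≡⟨ countSublists-∷ Q x xs ⟩
    countSublists Q xs + countSublists (Q ∘ (x ∷_)) xs  ≡⟨ cong₂ _+_ (countSublists-↭ Q-inv xs↭ys)
                                                             (countSublists-↭ (Q-inv ∘ prep x) xs↭ys) ⟩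
    countSublists Q ys + countSublists (Q ∘ (x ∷_)) ys  ≡⟨ countSublists-∷ Q x ys ⟨
    countSublists Q (x ∷ ys)                            ∎
  countSublists-↭ {Q = Q} Q-inv (swap {xs} {ys} x y xs↭ys) = begin
    countSublists Q (x ∷ y ∷ xs)
      ≡⟨ expand x y xs ⟩
    (countSublists Q xs + countSublists (Q ∘ (y ∷_)) xs) + (countSublists (Q ∘ (x ∷_)) xs + countSublists (Q ∘ (x ∷_) ∘ (y ∷_)) xs)
      ≡⟨ +-interchange (countSublists Q xs) _ _ _ ⟩
    (countSublists Q xs + countSublists (Q ∘ (x ∷_)) xs) + (countSublists (Q ∘ (y ∷_)) xs + countSublists (Q ∘ (x ∷_) ∘ (y ∷_)) xs)
      ≡⟨ cong₂ _+_ (cong₂ _+_ (countSublists-↭ Q-inv xs↭ys) (countSublists-↭ (Q-inv ∘ prep x) xs↭ys))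
                   (cong₂ _+_ (countSublists-↭ (Q-inv ∘ prep y) xs↭ys)
                              (≡.trans (countSublists-cong (λ zs → Q-inv (swap x y refl)) xs)
                                       (countSublists-↭ (Q-inv ∘ prep y ∘ prep x) xs↭ys))) ⟩
    (countSublists Q ys + countSublists (Q ∘ (x ∷_)) ys) + (countSublists (Q ∘ (y ∷_)) ys + countSublists (Q ∘ (y ∷_) ∘ (x ∷_)) ys)
      ≡⟨ expand y x ys ⟨
    countSublists Q (y ∷ x ∷ ys) ∎
    where
    expand : ∀ u v zs → countSublists Q (u ∷ v ∷ zs) ≡
      (countSublists Q zs + countSublists (Q ∘ (v ∷_)) zs) + (countSublists (Q ∘ (u ∷_)) zs + countSublists (Q ∘ (u ∷_) ∘ (v ∷_)) zs)
    expand u v zs = ≡.trans (countSublists-∷ Q u (v ∷ zs)) (cong₂ _+_ (countSublists-∷ Q v zs) (countSublists-∷ _ v zs))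
  countSublists-↭ Q-inv (trans p q) = ≡.trans (countSublists-↭ Q-inv p) (countSublists-↭ Q-inv q)

  Pos : Set
  Pos = ℕ × ℕ

  disjoint : ℕ → Pos → Pos → Bool
  disjoint s x y = not (overlaps s x y)

  near-sym : ∀ s a b → near s a b ≡ near s b a
  near-sym s a b = ∧-comm ((a ∸ b) <ᵇ s) ((b ∸ a) <ᵇ s)

  disjoint-sym : ∀ s x y → disjoint s x y ≡ disjoint s y x
  disjoint-sym s (i , j) (i′ , j′) = cong not (cong₂ _∧_ (near-sym s i i′) (near-sym s j j′))

  allB-↭ : (p : A → Bool) → PermutationInvariant (allB p)
  allB-↭ p refl          = ≡.refl
  allB-↭ p (prep x q)    = cong (p x ∧_) (allB-↭ p q)
  allB-↭ p (swap x y q)  = ≡.trans (∧-swapˡ (p x) (p y) _) (cong (λ b → p y ∧ (p x ∧ b)) (allB-↭ p q))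
  allB-↭ p (trans q q′)  = ≡.trans (allB-↭ p q) (allB-↭ p q′)

  nonOverlapping-↭ : ∀ s → PermutationInvariant (nonOverlapping s)
  nonOverlapping-↭ s refl         = ≡.refl
  nonOverlapping-↭ s (prep x q)   = cong₂ _∧_ (allB-↭ (disjoint s x) q) (nonOverlapping-↭ s q)
  nonOverlapping-↭ s (swap {xs} {ys} x y q) = begin
    (disjoint s x y ∧ allB (disjoint s x) xs) ∧ (allB (disjoint s y) xs ∧ nonOverlapping s xs)
      ≡⟨ ∧-interchange (disjoint s x y) _ _ _ ⟩
    (disjoint s x y ∧ allB (disjoint s y) xs) ∧ (allB (disjoint s x) xs ∧ nonOverlapping s xs)
      ≡⟨ cong₂ _∧_ (cong₂ _∧_ (disjoint-sym s x y) (allB-↭ (disjoint s y) q))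
                   (cong₂ _∧_ (allB-↭ (disjoint s x) q) (nonOverlapping-↭ s q)) ⟩
    (disjoint s y x ∧ allB (disjoint s y) ys) ∧ (allB (disjoint s x) ys ∧ nonOverlapping s ys) ∎
  nonOverlapping-↭ s (trans q q′) = ≡.trans (nonOverlapping-↭ s q) (nonOverlapping-↭ s q′)

  isTiling-↭ : ∀ s k → PermutationInvariant (isTiling s k)
  isTiling-↭ s k {xs} {ys} q = cong₂ _∧_ (cong (_≡ᵇ k) (↭-length q)) (nonOverlapping-↭ s q)

  tilings : ℕ → ℕ → List Pos → ℕ
  tilings s k = countSublists (isTiling s k)

  timesT : (ℕ → ℕ) → ℕ → ℕ
  timesT f zero    = 0
  timesT f (suc k) = f k

  tilings-∷ : ∀ s k x xs →
    tilings s k (x ∷ xs) ≡ tilings s k xs + timesT (λ j → tilings s j (filterᵇ (disjoint s x) xs)) k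
  tilings-∷ s zero    x xs = ≡.trans (countSublists-∷ _ x xs) (cong (tilings s 0 xs +_) (countᵇ-false (sublists xs)))
  tilings-∷ s (suc k) x xs = ≡.trans (countSublists-∷ _ x xs) (cong (tilings s (suc k) xs +_) (begin
    countSublists (λ ys → (length ys ≡ᵇ k) ∧ (allB (disjoint s x) ys ∧ nonOverlapping s ys)) xs
      ≡⟨ countSublists-cong (λ ys → ∧-swapˡ (length ys ≡ᵇ k) (allB (disjoint s x) ys) _) xs ⟩
    countSublists (λ ys → allB (disjoint s x) ys ∧ isTiling s k ys) xs
      ≡⟨ countSublists-allB (disjoint s x) (isTiling s k) xs ⟩
    tilings s k (filterᵇ (disjoint s x) xs) ∎))

open Counting

module Comparison where

  open import Data.Bool using (true; false; _∧_; T)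
  open import Data.Bool.Properties using (T-≡; ¬-not)
  open import Data.Nat using (suc; zero; _+_; _∸_; _≤_; _<_; _<ᵇ_; _≤ᵇ_; _≡ᵇ_)
  open import Data.Nat.Properties using (<⇒<ᵇ; <ᵇ⇒<; ≤⇒≤ᵇ; ≤ᵇ⇒≤; <⇒≱; ≡ᵇ⇒≡; ≡⇒≡ᵇ)
  open import Function using (Equivalence)
  open import Relation.Binary.PropositionalEquality as ≡ using (_≢_; cong; sym; subst)
  open Equivalence using (to)

  <ᵇ-true : ∀ {m n} → m < n → (m <ᵇ n) ≡ true
  <ᵇ-true m<n = to T-≡ (<⇒<ᵇ m<n)

  <ᵇ-false : ∀ {m n} → n ≤ m → (m <ᵇ n) ≡ false
  <ᵇ-false {m} {n} n≤m = ¬-not (λ m<ᵇn → <⇒≱ (<ᵇ⇒< m n (subst T (sym m<ᵇn) _)) n≤m)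

  ≤ᵇ-true : ∀ {m n} → m ≤ n → (m ≤ᵇ n) ≡ true
  ≤ᵇ-true m≤n = to T-≡ (≤⇒≤ᵇ m≤n)

  ≤ᵇ-false : ∀ {m n} → n < m → (m ≤ᵇ n) ≡ false
  ≤ᵇ-false {m} {n} n<m = ¬-not (λ m≤ᵇn → <⇒≱ n<m (≤ᵇ⇒≤ m n (subst T (sym m≤ᵇn) _)))

  ≡ᵇ-refl : ∀ n → (n ≡ᵇ n) ≡ true
  ≡ᵇ-refl n = to T-≡ (≡⇒≡ᵇ n n ≡.refl)

  ≡ᵇ-false : ∀ {m n} → m ≢ n → (m ≡ᵇ n) ≡ false
  ≡ᵇ-false {m} {n} m≢n = ¬-not (λ m≡ᵇn → m≢n (≡ᵇ⇒≡ m n (subst T (sym m≡ᵇn) _)))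

  <ᵇ-suc : ∀ x m → (x <ᵇ suc m) ≡ (x ≤ᵇ m)
  <ᵇ-suc zero    m = ≡.refl
  <ᵇ-suc (suc x) m = ≡.refl

  ≤ᵇ-+ : ∀ a a′ m → (a + a′ ≤ᵇ m) ≡ (a ≤ᵇ m) ∧ (a′ ≤ᵇ m ∸ a)
  ≤ᵇ-+ zero    a′ m       = ≡.refl
  ≤ᵇ-+ (suc a) a′ zero    = ≡.refl
  ≤ᵇ-+ (suc a) a′ (suc m) = ≡.trans (<ᵇ-suc (a + a′) m) (≡.trans (≤ᵇ-+ a a′ m) (cong (_∧ (a′ ≤ᵇ m ∸ a)) (sym (<ᵇ-suc a m))))

open Comparison

module Strip where

  open import Data.Bool using (Bool; true; false; _∧_; not)
  open import Data.Bool.Properties using (T?; ∧-identityʳ; ∧-comm; ∧-idem; not-involutive)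
  open import Data.Nat using (zero; suc; _+_; _∸_; _<ᵇ_; _≤_; _<_; _⊔_; z≤n; s≤s; _<?_)
  open import Data.Nat.Properties using (+-comm; ≤-refl; ≤-trans; <⇒≤; <⇒≱; ≮⇒≥; ≤-pred; +-monoʳ-≤;
    m≤n+m∸n; m≤n+o⇒m∸n≤o; m∸n≤m; ∸-mono; m≤n⇒m∸n≡0; m<n⇒m<1+n; n<1+n; n≤1+n; m≤n⇒m⊔n≡n;
    m≥n⇒m⊔n≡m; ⊔-lub; m≤m⊔n; m≤n⊔m; m∸n+n≡m; ≤ᵇ⇒≤; m≤n+m; ⊔-idem)
  open import Data.List using (List; []; _∷_; _++_; map; filterᵇ; upTo)
  open import Data.List.Properties using (filter-++)
  open import Data.Product using (_,_; proj₁)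
  open import Function using (_∘_)
  open import Relation.Nullary using (yes; no)
  open import Relation.Binary.PropositionalEquality as ≡ using (cong; cong₂; sym; subst)
  open ≡.≡-Reasoning

  private variable
    A : Set

  ∸-≤-swap : ∀ {m n o} → m ∸ n ≤ o → m ∸ o ≤ n
  ∸-≤-swap {m} {n} {o} m∸n≤o =
    m≤n+o⇒m∸n≤o m o (subst (m ≤_) (+-comm n o) (≤-trans (m≤n+m∸n m n) (+-monoʳ-≤ n m∸n≤o)))

  near-behind : ∀ {h j} → j < h → near 6 h j ≡ not (j <ᵇ h ∸ 5)
  near-behind {h} {j} j<h rewrite m≤n⇒m∸n≡0 (<⇒≤ j<h) | ∧-identityʳ ((h ∸ j) <ᵇ 6) with j <? h ∸ 5
  ... | yes j<h∸5 = ≡.trans (<ᵇ-false (≮⇒≥ λ lt → <⇒≱ j<h∸5 (∸-≤-swap (≤-pred lt))))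
                            (cong not (sym (<ᵇ-true j<h∸5)))
  ... | no  j≮h∸5 = ≡.trans (<ᵇ-true (s≤s (∸-≤-swap (≮⇒≥ j≮h∸5)))) (cong not (sym (<ᵇ-false (≮⇒≥ j≮h∸5))))

  near-self : ∀ h → near 6 h h ≡ true
  near-self h rewrite m≤n⇒m∸n≡0 (≤-refl {h}) = ≡.refl

  Spans : ℕ → Set
  Spans a = ∀ i → i ≤ 6 → near 6 a i ≡ true

  central-spans : ∀ {a} → 1 ≤ a → a ≤ 5 → Spans a
  central-spans {a} 1≤a a≤5 i i≤6
    rewrite <ᵇ-true {a ∸ i} {6} (s≤s (≤-trans (m∸n≤m a i) a≤5))
          | <ᵇ-true {i ∸ a} {6} (s≤s (∸-mono i≤6 1≤a)) = ≡.refl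

  filterᵇ-filterᵇ : (p q : A → Bool) (xs : List A) → filterᵇ p (filterᵇ q xs) ≡ filterᵇ (λ x → q x ∧ p x) xs
  filterᵇ-filterᵇ p q []       = ≡.refl
  filterᵇ-filterᵇ p q (x ∷ xs) with q x
  ... | false = filterᵇ-filterᵇ p q xs
  ... | true with p x
  ...   | true  = cong (x ∷_) (filterᵇ-filterᵇ p q xs)
  ...   | false = filterᵇ-filterᵇ p q xs

  filterᵇ-map-cong : {B : Set} {p q : B → Bool} (f : A → B) → (∀ a → p (f a) ≡ q (f a)) →
    (as : List A) → filterᵇ p (map f as) ≡ filterᵇ q (map f as)
  filterᵇ-map-cong f p≗q []       = ≡.refl
  filterᵇ-map-cong {p = p} {q} f p≗q (a ∷ as) with p (f a) | q (f a) | p≗q a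
  ... | true  | .true  | ≡.refl = cong (f a ∷_) (filterᵇ-map-cong f p≗q as)
  ... | false | .false | ≡.refl = filterᵇ-map-cong f p≗q as

  -- A corner (i , j) is the 6 × 6 square on rows i … i + 5 and columns j … j + 5; the grid lists
  -- the corners of the 12-row strip column by column, starting from the right.

  column : ℕ → List Pos
  column j = map (_, j) (upTo 7)

  grid : ℕ → List Pos
  grid zero    = []
  grid (suc j) = column j ++ grid j

  -- A square in row offset i needs the lower half of the strip iff i ≤ 5 and the upper half iff i ≥ 1.
  rowAllowed : ℕ → Bool → Bool → Bool
  rowAllowed 0 lower upper = lower
  rowAllowed 1 lower upper = lower ∧ upper
  rowAllowed 2 lower upper = lower ∧ upper
  rowAllowed 3 lower upper = lower ∧ upper
  rowAllowed 4 lower upper = lower ∧ upper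
  rowAllowed 5 lower upper = lower ∧ upper
  rowAllowed 6 lower upper = upper
  rowAllowed (suc (suc (suc (suc (suc (suc (suc _))))))) lower upper = false

  -- the corners of the region whose lower half offers b corner columns and whose upper half offers t
  inStrip : ℕ → ℕ → Pos → Bool
  inStrip b t (i , j) = rowAllowed i (j <ᵇ b) (j <ᵇ t)

  strip : ℕ → ℕ → List Pos
  strip b t = filterᵇ (inStrip b t) (grid (b ⊔ t))

  filterᵇ-column : ∀ {p q : Pos → Bool} j → (∀ i → p (i , j) ≡ q (i , j)) → filterᵇ p (column j) ≡ filterᵇ q (column j)
  filterᵇ-column {p} {q} j p≗q = filterᵇ-map-cong {p = p} {q} (_, j) p≗q (upTo 7)

  filterᵇ-grid-cong : ∀ {p q : Pos → Bool} n → (∀ i j → j < n → p (i , j) ≡ q (i , j)) →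
    filterᵇ p (grid n) ≡ filterᵇ q (grid n)
  filterᵇ-grid-cong zero    p≗q = ≡.refl
  filterᵇ-grid-cong {p} {q} (suc n) p≗q = begin
    filterᵇ p (column n ++ grid n)              ≡⟨ filter-++ (T? ∘ p) (column n) (grid n) ⟩
    filterᵇ p (column n) ++ filterᵇ p (grid n)  ≡⟨ cong₂ _++_ (filterᵇ-column {p} {q} n (λ i → p≗q i n (n<1+n n)))
                                                     (filterᵇ-grid-cong {p} {q} n (λ i j j<n → p≗q i j (m<n⇒m<1+n j<n))) ⟩
    filterᵇ q (column n) ++ filterᵇ q (grid n)  ≡⟨ filter-++ (T? ∘ q) (column n) (grid n) ⟨
    filterᵇ q (column n ++ grid n)              ∎

  strip-grid : ∀ {b t n} → b ≤ n → t ≤ n → filterᵇ (inStrip b t) (grid n) ≡ strip b t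
  strip-grid {b} {t} {n} b≤n t≤n = ≡.trans (cong (filterᵇ (inStrip b t) ∘ grid) (sym (m∸n+n≡m (⊔-lub b≤n t≤n))))
                                           (drop-columns (n ∸ (b ⊔ t)))
    where
    drop-columns : ∀ d → filterᵇ (inStrip b t) (grid (d + (b ⊔ t))) ≡ strip b t
    drop-columns zero    = ≡.refl
    drop-columns (suc d) = begin
      filterᵇ (inStrip b t) (column (d + (b ⊔ t)) ++ grid (d + (b ⊔ t)))
        ≡⟨ filter-++ (T? ∘ inStrip b t) (column (d + (b ⊔ t))) _ ⟩
      filterᵇ (inStrip b t) (column (d + (b ⊔ t))) ++ filterᵇ (inStrip b t) (grid (d + (b ⊔ t)))
        ≡⟨ cong₂ _++_ (filterᵇ-column {p = inStrip b t} {q = λ x → rowAllowed (proj₁ x) false false} _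
                         (λ i → cong₂ (rowAllowed i) (<ᵇ-false (beyond (m≤m⊔n b t))) (<ᵇ-false (beyond (m≤n⊔m b t)))))
                      (drop-columns d) ⟩
      [] ++ strip b t ∎
      where
      beyond : ∀ {x} → x ≤ b ⊔ t → x ≤ d + (b ⊔ t)
      beyond x≤ = ≤-trans x≤ (m≤n+m (b ⊔ t) d)

  strip-peel : ∀ b t {b′ t′ h} → b ⊔ t ≡ suc h → b′ ≤ h → t′ ≤ h →
    (∀ i j → j < h → inStrip b t (i , j) ≡ inStrip b′ t′ (i , j)) →
    strip b t ≡ filterᵇ (inStrip b t) (column h) ++ strip b′ t′
  strip-peel b t {b′} {t′} {h} b⊔t≡1+h b′≤h t′≤h agree = begin
    filterᵇ (inStrip b t) (grid (b ⊔ t))                          ≡⟨ cong (filterᵇ (inStrip b t) ∘ grid) b⊔t≡1+h ⟩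
    filterᵇ (inStrip b t) (column h ++ grid h)                    ≡⟨ filter-++ (T? ∘ inStrip b t) (column h) (grid h) ⟩
    filterᵇ (inStrip b t) (column h) ++ filterᵇ (inStrip b t) (grid h)
      ≡⟨ cong (_ ++_) (≡.trans (filterᵇ-grid-cong {inStrip b t} {inStrip b′ t′} h agree) (strip-grid b′≤h t′≤h)) ⟩
    filterᵇ (inStrip b t) (column h) ++ strip b′ t′               ∎

  strip-top : ∀ {b h} → b ≤ h → strip b (suc h) ≡ (6 , h) ∷ strip b h
  strip-top {b} {h} b≤h = ≡.trans
    (strip-peel b (suc h) (m≤n⇒m⊔n≡n (≤-trans b≤h (n≤1+n h))) b≤h ≤-refl
       (λ i j j<h → cong (rowAllowed i (j <ᵇ b)) (≡.trans (<ᵇ-true (m<n⇒m<1+n j<h)) (sym (<ᵇ-true j<h)))))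
    (cong (_++ strip b h) (filterᵇ-column {inStrip b (suc h)} {λ x → rowAllowed (proj₁ x) false true} h
       (λ i → cong₂ (rowAllowed i) (<ᵇ-false b≤h) (<ᵇ-true (n<1+n h)))))

  strip-bottom : ∀ {t h} → t ≤ h → strip (suc h) t ≡ (0 , h) ∷ strip h t
  strip-bottom {t} {h} t≤h = ≡.trans
    (strip-peel (suc h) t (m≥n⇒m⊔n≡m (≤-trans t≤h (n≤1+n h))) ≤-refl t≤h
       (λ i j j<h → cong (λ lower → rowAllowed i lower (j <ᵇ t)) (≡.trans (<ᵇ-true (m<n⇒m<1+n j<h)) (sym (<ᵇ-true j<h)))))
    (cong (_++ strip h t) (filterᵇ-column {inStrip (suc h) t} {λ x → rowAllowed (proj₁ x) true false} h
       (λ i → cong₂ (rowAllowed i) (<ᵇ-true (n<1+n h)) (<ᵇ-false t≤h))))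

  strip-level : ∀ h → strip (suc h) (suc h) ≡ column h ++ strip h h
  strip-level h = ≡.trans
    (strip-peel (suc h) (suc h) (⊔-idem (suc h)) ≤-refl ≤-refl
       (λ i j j<h → cong₂ (rowAllowed i) (below j<h) (below j<h)))
    (cong (_++ strip h h) (filterᵇ-column {inStrip (suc h) (suc h)} {λ x → rowAllowed (proj₁ x) true true} h
       (λ i → cong₂ (rowAllowed i) (<ᵇ-true (n<1+n h)) (<ᵇ-true (n<1+n h)))))
    where
    below : ∀ {j} → j < h → (j <ᵇ suc h) ≡ (j <ᵇ h)
    below j<h = ≡.trans (<ᵇ-true (m<n⇒m<1+n j<h)) (sym (<ᵇ-true j<h))

  strip-cut : ∀ x {b t b′ t′ h} → b ≤ h → t ≤ h → b′ ≤ h → t′ ≤ h →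
    (∀ i j → j < h → inStrip b t (i , j) ∧ disjoint 6 x (i , j) ≡ inStrip b′ t′ (i , j)) →
    filterᵇ (disjoint 6 x) (strip b t) ≡ strip b′ t′
  strip-cut x {b} {t} {b′} {t′} {h} b≤h t≤h b′≤h t′≤h agree = begin
    filterᵇ (disjoint 6 x) (strip b t)                            ≡⟨ cong (filterᵇ (disjoint 6 x)) (strip-grid b≤h t≤h) ⟨
    filterᵇ (disjoint 6 x) (filterᵇ (inStrip b t) (grid h))       ≡⟨ filterᵇ-filterᵇ (disjoint 6 x) (inStrip b t) (grid h) ⟩
    filterᵇ (λ y → inStrip b t y ∧ disjoint 6 x y) (grid h)       ≡⟨ filterᵇ-grid-cong h agree ⟩
    filterᵇ (inStrip b′ t′) (grid h)                              ≡⟨ strip-grid b′≤h t′≤h ⟩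
    strip b′ t′                                                   ∎

  rowAllowed-top-cut : ∀ i lower c → rowAllowed i lower true ∧ not (near 6 6 i ∧ not c) ≡ rowAllowed i lower c
  rowAllowed-top-cut 0 lower c = ∧-identityʳ lower
  rowAllowed-top-cut 1 lower c = cong₂ _∧_ (∧-identityʳ lower) (not-involutive c)
  rowAllowed-top-cut 2 lower c = cong₂ _∧_ (∧-identityʳ lower) (not-involutive c)
  rowAllowed-top-cut 3 lower c = cong₂ _∧_ (∧-identityʳ lower) (not-involutive c)
  rowAllowed-top-cut 4 lower c = cong₂ _∧_ (∧-identityʳ lower) (not-involutive c)
  rowAllowed-top-cut 5 lower c = cong₂ _∧_ (∧-identityʳ lower) (not-involutive c)
  rowAllowed-top-cut 6 lower c = not-involutive c
  rowAllowed-top-cut (suc (suc (suc (suc (suc (suc (suc _))))))) lower c = ≡.refl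

  rowAllowed-bottom-cut : ∀ i upper c → rowAllowed i true upper ∧ not (near 6 0 i ∧ not c) ≡ rowAllowed i c upper
  rowAllowed-bottom-cut 0 upper c = not-involutive c
  rowAllowed-bottom-cut 1 upper c = ≡.trans (cong (upper ∧_) (not-involutive c)) (∧-comm upper c)
  rowAllowed-bottom-cut 2 upper c = ≡.trans (cong (upper ∧_) (not-involutive c)) (∧-comm upper c)
  rowAllowed-bottom-cut 3 upper c = ≡.trans (cong (upper ∧_) (not-involutive c)) (∧-comm upper c)
  rowAllowed-bottom-cut 4 upper c = ≡.trans (cong (upper ∧_) (not-involutive c)) (∧-comm upper c)
  rowAllowed-bottom-cut 5 upper c = ≡.trans (cong (upper ∧_) (not-involutive c)) (∧-comm upper c)
  rowAllowed-bottom-cut 6 upper c = ∧-identityʳ upper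
  rowAllowed-bottom-cut (suc (suc (suc (suc (suc (suc (suc _))))))) upper c = ≡.refl

  rowAllowed-central-cut : ∀ {a} → Spans a → ∀ i c → rowAllowed i true true ∧ not (near 6 a i ∧ not c) ≡ rowAllowed i c c
  rowAllowed-central-cut spans 0 c rewrite spans 0 z≤n = not-involutive c
  rowAllowed-central-cut spans 1 c rewrite spans 1 (≤ᵇ⇒≤ 1 6 _) = ≡.trans (not-involutive c) (sym (∧-idem c))
  rowAllowed-central-cut spans 2 c rewrite spans 2 (≤ᵇ⇒≤ 2 6 _) = ≡.trans (not-involutive c) (sym (∧-idem c))
  rowAllowed-central-cut spans 3 c rewrite spans 3 (≤ᵇ⇒≤ 3 6 _) = ≡.trans (not-involutive c) (sym (∧-idem c))
  rowAllowed-central-cut spans 4 c rewrite spans 4 (≤ᵇ⇒≤ 4 6 _) = ≡.trans (not-involutive c) (sym (∧-idem c))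
  rowAllowed-central-cut spans 5 c rewrite spans 5 (≤ᵇ⇒≤ 5 6 _) = ≡.trans (not-involutive c) (sym (∧-idem c))
  rowAllowed-central-cut spans 6 c rewrite spans 6 ≤-refl = not-involutive c
  rowAllowed-central-cut spans (suc (suc (suc (suc (suc (suc (suc _))))))) c = ≡.refl

  strip-top-cut : ∀ {b h} → b ≤ h → filterᵇ (disjoint 6 (6 , h)) (strip b h) ≡ strip b (h ∸ 5)
  strip-top-cut {b} {h} b≤h = strip-cut (6 , h) b≤h ≤-refl b≤h (m∸n≤m h 5) agree
    where
    agree : ∀ i j → j < h → inStrip b h (i , j) ∧ disjoint 6 (6 , h) (i , j) ≡ inStrip b (h ∸ 5) (i , j)
    agree i j j<h rewrite <ᵇ-true j<h | near-behind j<h = rowAllowed-top-cut i (j <ᵇ b) (j <ᵇ h ∸ 5)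

  strip-bottom-cut : ∀ {t h} → t ≤ h → filterᵇ (disjoint 6 (0 , h)) (strip h t) ≡ strip (h ∸ 5) t
  strip-bottom-cut {t} {h} t≤h = strip-cut (0 , h) ≤-refl t≤h (m∸n≤m h 5) t≤h agree
    where
    agree : ∀ i j → j < h → inStrip h t (i , j) ∧ disjoint 6 (0 , h) (i , j) ≡ inStrip (h ∸ 5) t (i , j)
    agree i j j<h rewrite <ᵇ-true j<h | near-behind j<h = rowAllowed-bottom-cut i (j <ᵇ t) (j <ᵇ h ∸ 5)

  strip-central-cut : ∀ {a h} → Spans a → filterᵇ (disjoint 6 (a , h)) (strip h h) ≡ strip (h ∸ 5) (h ∸ 5)
  strip-central-cut {a} {h} spans = strip-cut (a , h) ≤-refl ≤-refl (m∸n≤m h 5) (m∸n≤m h 5) agree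
    where
    agree : ∀ i j → j < h → inStrip h h (i , j) ∧ disjoint 6 (a , h) (i , j) ≡ inStrip (h ∸ 5) (h ∸ 5) (i , j)
    agree i j j<h rewrite <ᵇ-true j<h | near-behind j<h = rowAllowed-central-cut spans i (j <ᵇ h ∸ 5)

  filterᵇ-disjoint-column : ∀ a h is →
    filterᵇ (disjoint 6 (a , h)) (map (_, h) is) ≡ filterᵇ (λ x → not (near 6 a (proj₁ x))) (map (_, h) is)
  filterᵇ-disjoint-column a h = filterᵇ-map-cong {p = disjoint 6 (a , h)} (_, h)
    (λ i → ≡.trans (cong (λ b → not (near 6 a i ∧ b)) (near-self h)) (cong not (∧-identityʳ (near 6 a i))))

open Strip

module Transfer where

  open import Data.Bool using (not; T)
  open import Data.Bool.Properties using (T?)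
  open import Data.Nat using (suc; _+_; _*_; _∸_; _≤_; _≤ᵇ_)
  open import Data.Nat.Properties using (≤-refl; m≤n+o⇒m∸n≤o; m≤n⇒m∸n≡0; m∸n≤m; ≤ᵇ⇒≤)
  open import Data.Nat.Tactic.RingSolver using (solve-∀)
  open import Data.List using (List; []; _∷_; _++_; map; filterᵇ)
  open import Data.List.Properties using (filter-++)
  open import Data.Product using (_,_; proj₁)
  open import Function using (_∘_)
  open import Relation.Binary.PropositionalEquality as ≡ using (cong; cong₂)
  open ≡.≡-Reasoning

  -- T₁₂ a c k: tilings with k big squares of the region whose lower six rows have length a and
  -- whose upper six rows have length c (a half of length ≤ 5 has no room for a big square)
  T₁₂ : ℕ → ℕ → ℕ → ℕ
  T₁₂ a c k = tilings 6 k (strip (a ∸ 5) (c ∸ 5))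

  T₁₂-short : ∀ {a c} k → a ≤ 5 → c ≤ 5 → T₁₂ a c k ≡ T₁₂ 0 0 k
  T₁₂-short k a≤5 c≤5 rewrite m≤n⇒m∸n≡0 a≤5 | m≤n⇒m∸n≡0 c≤5 = ≡.refl

  T₁₂-upper : ∀ {a} b k → a ≤ 5 + b → T₁₂ a (6 + b) k ≡ T₁₂ a (5 + b) k + timesT (T₁₂ a b) k
  T₁₂-upper {a} b k a≤5+b = begin
    tilings 6 k (strip (a ∸ 5) (suc b))
      ≡⟨ cong (tilings 6 k) (strip-top a∸5≤b) ⟩
    tilings 6 k ((6 , b) ∷ strip (a ∸ 5) b)
      ≡⟨ tilings-∷ 6 k (6 , b) (strip (a ∸ 5) b) ⟩
    T₁₂ a (5 + b) k + timesT (λ j → tilings 6 j (filterᵇ (disjoint 6 (6 , b)) (strip (a ∸ 5) b))) k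
      ≡⟨ cong (λ s → T₁₂ a (5 + b) k + timesT (λ j → tilings 6 j s) k) (strip-top-cut a∸5≤b) ⟩
    T₁₂ a (5 + b) k + timesT (T₁₂ a b) k ∎
    where a∸5≤b = m≤n+o⇒m∸n≤o a 5 a≤5+b

  T₁₂-lower : ∀ {c} b k → c ≤ 5 + b → T₁₂ (6 + b) c k ≡ T₁₂ (5 + b) c k + timesT (T₁₂ b c) k
  T₁₂-lower {c} b k c≤5+b = begin
    tilings 6 k (strip (suc b) (c ∸ 5))
      ≡⟨ cong (tilings 6 k) (strip-bottom c∸5≤b) ⟩
    tilings 6 k ((0 , b) ∷ strip b (c ∸ 5))
      ≡⟨ tilings-∷ 6 k (0 , b) (strip b (c ∸ 5)) ⟩
    T₁₂ (5 + b) c k + timesT (λ j → tilings 6 j (filterᵇ (disjoint 6 (0 , b)) (strip b (c ∸ 5)))) k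
      ≡⟨ cong (λ s → T₁₂ (5 + b) c k + timesT (λ j → tilings 6 j s) k) (strip-bottom-cut c∸5≤b) ⟩
    T₁₂ (5 + b) c k + timesT (T₁₂ b c) k ∎
    where c∸5≤b = m≤n+o⇒m∸n≤o c 5 c≤5+b

  central-step : ∀ {h} k a is → Spans a → filterᵇ (λ x → not (near 6 a (proj₁ x))) (map (_, h) is) ≡ [] →
    tilings 6 k ((a , h) ∷ map (_, h) is ++ strip h h) ≡
    tilings 6 k (map (_, h) is ++ strip h h) + timesT (λ j → tilings 6 j (strip (h ∸ 5) (h ∸ 5))) k
  central-step {h} k a is spans clears = ≡.trans (tilings-∷ 6 k (a , h) (map (_, h) is ++ strip h h))
    (cong (λ s → tilings 6 k (map (_, h) is ++ strip h h) + timesT (λ j → tilings 6 j s) k) (begin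
      filterᵇ (disjoint 6 (a , h)) (map (_, h) is ++ strip h h)
        ≡⟨ filter-++ (T? ∘ disjoint 6 (a , h)) (map (_, h) is) (strip h h) ⟩
      filterᵇ (disjoint 6 (a , h)) (map (_, h) is) ++ filterᵇ (disjoint 6 (a , h)) (strip h h)
        ≡⟨ cong₂ _++_ (≡.trans (filterᵇ-disjoint-column a h is) clears) (strip-central-cut {a} {h} spans) ⟩
      strip (h ∸ 5) (h ∸ 5) ∎))

  -- The last column holds a square in row 0 (possibly with one in row 6), or one in a central
  -- row 1 … 5 (which excludes all others), or at most one in row 6.
  T₁₂-level : ∀ b k →
    T₁₂ (6 + b) (6 + b) k ≡ (T₁₂ (5 + b) (6 + b) k + timesT (T₁₂ b (6 + b)) k) + 5 * timesT (T₁₂ b b) k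
  T₁₂-level b k = begin
    tilings 6 k (strip (suc b) (suc b))
      ≡⟨ cong (tilings 6 k) (strip-level b) ⟩
    tilings 6 k ((0 , b) ∷ rows (1 ∷ 2 ∷ 3 ∷ 4 ∷ 5 ∷ 6 ∷ []))
      ≡⟨ tilings-∷ 6 k (0 , b) (rows (1 ∷ 2 ∷ 3 ∷ 4 ∷ 5 ∷ 6 ∷ [])) ⟩
    tilings 6 k (rows (1 ∷ 2 ∷ 3 ∷ 4 ∷ 5 ∷ 6 ∷ [])) + timesT (λ j → tilings 6 j (filterᵇ (disjoint 6 (0 , b)) (rows (1 ∷ 2 ∷ 3 ∷ 4 ∷ 5 ∷ 6 ∷ [])))) k
      ≡⟨ cong₂ _+_ central-rows (cong (λ s → timesT (λ j → tilings 6 j s) k) lower-corner-cut) ⟩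
    ((((( tilings 6 k (rows (6 ∷ [])) + X) + X) + X) + X) + X) + timesT (T₁₂ b (6 + b)) k
      ≡⟨ rearrange (tilings 6 k (rows (6 ∷ []))) X _ ⟩
    (tilings 6 k ((6 , b) ∷ strip b b) + timesT (T₁₂ b (6 + b)) k) + 5 * X
      ≡⟨ cong (λ s → (tilings 6 k s + timesT (T₁₂ b (6 + b)) k) + 5 * X) (strip-top {b} {b} ≤-refl) ⟨
    (T₁₂ (5 + b) (6 + b) k + timesT (T₁₂ b (6 + b)) k) + 5 * X ∎
    where
    rows : List ℕ → List Pos
    rows is = map (_, b) is ++ strip b b

    X : ℕ
    X = timesT (T₁₂ b b) k

    lower-corner-cut : filterᵇ (disjoint 6 (0 , b)) (rows (1 ∷ 2 ∷ 3 ∷ 4 ∷ 5 ∷ 6 ∷ [])) ≡ strip (b ∸ 5) (suc b)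
    lower-corner-cut = begin
      filterᵇ (disjoint 6 (0 , b)) (rows (1 ∷ 2 ∷ 3 ∷ 4 ∷ 5 ∷ 6 ∷ []))
        ≡⟨ filter-++ (T? ∘ disjoint 6 (0 , b)) (map (_, b) (1 ∷ 2 ∷ 3 ∷ 4 ∷ 5 ∷ 6 ∷ [])) (strip b b) ⟩
      filterᵇ (disjoint 6 (0 , b)) (map (_, b) (1 ∷ 2 ∷ 3 ∷ 4 ∷ 5 ∷ 6 ∷ [])) ++ filterᵇ (disjoint 6 (0 , b)) (strip b b)
        ≡⟨ cong₂ _++_ (filterᵇ-disjoint-column 0 b (1 ∷ 2 ∷ 3 ∷ 4 ∷ 5 ∷ 6 ∷ [])) (strip-bottom-cut {b} {b} ≤-refl) ⟩
      (6 , b) ∷ strip (b ∸ 5) b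
        ≡⟨ strip-top (m∸n≤m b 5) ⟨
      strip (b ∸ 5) (suc b) ∎

    central : ∀ a is → T (1 ≤ᵇ a) → T (a ≤ᵇ 5) →
      filterᵇ (λ x → not (near 6 a (proj₁ x))) (map (_, b) is) ≡ [] →
      tilings 6 k (rows (a ∷ is)) ≡ tilings 6 k (rows is) + X
    central a is 1≤a a≤5 = central-step k a is (central-spans (≤ᵇ⇒≤ 1 a 1≤a) (≤ᵇ⇒≤ a 5 a≤5))

    central-rows : tilings 6 k (rows (1 ∷ 2 ∷ 3 ∷ 4 ∷ 5 ∷ 6 ∷ [])) ≡ ((((tilings 6 k (rows (6 ∷ [])) + X) + X) + X) + X) + X
    central-rows =
      ≡.trans (central 1 (2 ∷ 3 ∷ 4 ∷ 5 ∷ 6 ∷ []) _ _ ≡.refl) (cong (_+ X)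
     (≡.trans (central 2 (3 ∷ 4 ∷ 5 ∷ 6 ∷ []) _ _ ≡.refl) (cong (_+ X)
     (≡.trans (central 3 (4 ∷ 5 ∷ 6 ∷ []) _ _ ≡.refl) (cong (_+ X)
     (≡.trans (central 4 (5 ∷ 6 ∷ []) _ _ ≡.refl) (cong (_+ X)
              (central 5 (6 ∷ []) _ _ ≡.refl))))))))

    rearrange : ∀ r x y → (((((r + x) + x) + x) + x) + x) + y ≡ (r + y) + 5 * x
    rearrange = solve-∀

open Transfer

module Positions where

  open import Data.Nat using (zero; suc; _∸_)
  open import Data.List using (List; []; _∷_; _++_; map; upTo; cartesianProduct; _∷ʳ_; [_])
  open import Data.List.Properties using (upTo-∷ʳ; map-++; ++-assoc)
  open import Data.List.Relation.Binary.Permutation.Propositional using (_↭_; prep; ↭-reflexive; module PermutationReasoning)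
  open import Data.List.Relation.Binary.Permutation.Propositional.Properties using (shift; shifts; ++⁺ˡ)
  open import Data.Product using (_,_)
  open import Relation.Binary.PropositionalEquality as ≡ using (cong)

  corners-6 : ∀ m → corners 6 m ≡ upTo (m ∸ 5)
  corners-6 0 = ≡.refl
  corners-6 1 = ≡.refl
  corners-6 2 = ≡.refl
  corners-6 3 = ≡.refl
  corners-6 4 = ≡.refl
  corners-6 5 = ≡.refl
  corners-6 (suc (suc (suc (suc (suc (suc _)))))) = ≡.refl

  cartesianProduct-∷ʳ : ∀ {A B : Set} (xs : List A) (ys : List B) y →
    cartesianProduct xs (ys ∷ʳ y) ↭ map (_, y) xs ++ cartesianProduct xs ys
  cartesianProduct-∷ʳ []       ys y = ↭-reflexive ≡.refl
  cartesianProduct-∷ʳ (x ∷ xs) ys y = begin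
    map (x ,_) (ys ∷ʳ y) ++ cartesianProduct xs (ys ∷ʳ y)
      ≡⟨ cong (_++ cartesianProduct xs (ys ∷ʳ y)) (map-++ (x ,_) ys [ y ]) ⟩
    (map (x ,_) ys ∷ʳ (x , y)) ++ cartesianProduct xs (ys ∷ʳ y)
      ↭⟨ ++⁺ˡ (map (x ,_) ys ∷ʳ (x , y)) (cartesianProduct-∷ʳ xs ys y) ⟩
    (map (x ,_) ys ∷ʳ (x , y)) ++ (map (_, y) xs ++ cartesianProduct xs ys)
      ≡⟨ ++-assoc (map (x ,_) ys) [ x , y ] _ ⟩
    map (x ,_) ys ++ (x , y) ∷ (map (_, y) xs ++ cartesianProduct xs ys)
      ↭⟨ shift (x , y) (map (x ,_) ys) _ ⟩
    (x , y) ∷ map (x ,_) ys ++ map (_, y) xs ++ cartesianProduct xs ys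
      ↭⟨ prep (x , y) (shifts (map (x ,_) ys) (map (_, y) xs)) ⟩
    (x , y) ∷ map (_, y) xs ++ map (x ,_) ys ++ cartesianProduct xs ys ∎
    where open PermutationReasoning

  grid-↭ : ∀ n → cartesianProduct (upTo 7) (upTo n) ↭ grid n
  grid-↭ zero    = ↭-reflexive ≡.refl
  grid-↭ (suc n) = begin
    cartesianProduct (upTo 7) (upTo (suc n))         ≡⟨ cong (cartesianProduct (upTo 7)) (upTo-∷ʳ n) ⟨
    cartesianProduct (upTo 7) (upTo n ∷ʳ n)          ↭⟨ cartesianProduct-∷ʳ (upTo 7) (upTo n) n ⟩
    column n ++ cartesianProduct (upTo 7) (upTo n)   ↭⟨ ++⁺ˡ (column n) (grid-↭ n) ⟩
    column n ++ grid n                               ∎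
    where open PermutationReasoning

  strip-diagonal : ∀ n → strip n n ≡ grid n
  strip-diagonal zero    = ≡.refl
  strip-diagonal (suc n) = ≡.trans (strip-level n) (cong (column n ++_) (strip-diagonal n))

  T-count≡T₁₂ : ∀ m k → T-count 12 m 6 k ≡ T₁₂ m m k
  T-count≡T₁₂ m k = begin
    T-count 12 m 6 k                                   ≡⟨ length-filterᵇ (isTiling 6 k) (sublists (positions 12 m 6)) ⟩
    tilings 6 k (cartesianProduct (upTo 7) (corners 6 m)) ≡⟨ cong (λ cs → tilings 6 k (cartesianProduct (upTo 7) cs)) (corners-6 m) ⟩
    tilings 6 k (cartesianProduct (upTo 7) (upTo (m ∸ 5))) ≡⟨ countSublists-↭ (isTiling-↭ 6 k) (grid-↭ (m ∸ 5)) ⟩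
    tilings 6 k (grid (m ∸ 5))                          ≡⟨ cong (tilings 6 k) (strip-diagonal (m ∸ 5)) ⟨
    T₁₂ m m k                                           ∎
    where open ≡.≡-Reasoning

open Positions

module Series where

  open import Data.Bool using (true; false; _∧_; if_then_else_)
  open import Data.Nat as ℕ using (zero; suc; _∸_; _<_; _≤ᵇ_; _≡ᵇ_; s≤s)
  open import Data.Nat.Properties using (<-cmp; ≤-refl; ≤-pred; <⇒≤; <-trans; m<n⇒m<1+n; n<1+n; m<n⇒0<n∸m; n∸n≡0; ∸-+-assoc)
  open import Data.Integer using (+_; _+_; _*_)
  open import Data.Integer.Properties using (+-identityʳ; +-identityˡ; *-zeroʳ; *-identityʳ; *-distribʳ-+; +-commutativeSemigroup)
  open import Algebra.Properties.CommutativeSemigroup +-commutativeSemigroup using (interchange)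
  open import Data.List using (_∷_)
  open import Data.Product using (_,_)
  open import Relation.Binary using (tri<; tri≈; tri>)
  open import Relation.Binary.PropositionalEquality as ≡ using (cong; cong₂; sym)
  open ≡.≡-Reasoning

  shift : ℕ → ℕ → PowerSeries → PowerSeries
  shift a b f m k = if (a ≤ᵇ m) ∧ (b ≤ᵇ k) then f (m ∸ a) (k ∸ b) else + 0

  unit : PowerSeries
  unit zero    zero    = + 1
  unit zero    (suc _) = + 0
  unit (suc _) _       = + 0

  monomial : ℤ → ℕ → ℕ → PowerSeries
  monomial c a b m k = if (a ≡ᵇ m) ∧ (b ≡ᵇ k) then c else + 0

  poly-∷ : ∀ c a b ms m k → poly ((c , a , b) ∷ ms) m k ≡ monomial c a b m k + poly ms m k
  poly-∷ c a b ms m k with (a ≡ᵇ m) ∧ (b ≡ᵇ k)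
  ... | true  = ≡.refl
  ... | false = sym (+-identityˡ (poly ms m k))

  sumTo-cong : ∀ n {f g : ℕ → ℤ} → (∀ i → f i ≡ g i) → sumTo n f ≡ sumTo n g
  sumTo-cong zero    f≗g = f≗g 0
  sumTo-cong (suc n) f≗g = cong₂ _+_ (sumTo-cong n f≗g) (f≗g (suc n))

  sumTo-+ : ∀ n (f g : ℕ → ℤ) → sumTo n (λ i → f i + g i) ≡ sumTo n f + sumTo n g
  sumTo-+ zero    f g = ≡.refl
  sumTo-+ (suc n) f g = begin
    sumTo n (λ i → f i + g i) + (f (suc n) + g (suc n))  ≡⟨ cong (_+ (f (suc n) + g (suc n))) (sumTo-+ n f g) ⟩
    (sumTo n f + sumTo n g) + (f (suc n) + g (suc n))    ≡⟨ interchange (sumTo n f) (sumTo n g) (f (suc n)) (g (suc n)) ⟩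
    (sumTo n f + f (suc n)) + (sumTo n g + g (suc n))    ∎

  sumTo-zero : ∀ n → sumTo n (λ _ → + 0) ≡ + 0
  sumTo-zero zero    = ≡.refl
  sumTo-zero (suc n) = cong (_+ + 0) (sumTo-zero n)

  sumTo-last : ∀ n (f : ℕ → ℤ) → (∀ i → i < n → f i ≡ + 0) → sumTo n f ≡ f n
  sumTo-last zero    f vanish = ≡.refl
  sumTo-last (suc n) f vanish = begin
    sumTo n f + f (suc n)  ≡⟨ cong (_+ f (suc n)) (≡.trans (sumTo-last n f (λ i i<n → vanish i (m<n⇒m<1+n i<n))) (vanish n (n<1+n n))) ⟩
    + 0 + f (suc n)        ≡⟨ +-identityˡ (f (suc n)) ⟩
    f (suc n)              ∎

  sumTo-delta : ∀ a n (f : ℕ → ℤ) → sumTo n (λ i → if a ≡ᵇ i then f i else + 0) ≡ (if a ≤ᵇ n then f a else + 0)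
  sumTo-delta zero    zero    f = ≡.refl
  sumTo-delta (suc a) zero    f = ≡.refl
  sumTo-delta a       (suc n) f rewrite sumTo-delta a n f with <-cmp a (suc n)
  ... | tri< a<1+n a≢1+n _ rewrite ≤ᵇ-true (≤-pred a<1+n) | ≡ᵇ-false a≢1+n | ≤ᵇ-true (<⇒≤ a<1+n) = +-identityʳ (f a)
  ... | tri≈ _ ≡.refl _ rewrite ≤ᵇ-false (n<1+n n) | ≡ᵇ-refl (suc n) | ≤ᵇ-true (≤-refl {suc n}) = +-identityˡ (f (suc n))
  ... | tri> _ a≢1+n 1+n<a rewrite ≤ᵇ-false (<-trans (n<1+n n) 1+n<a) | ≡ᵇ-false a≢1+n | ≤ᵇ-false 1+n<a = ≡.refl

  ⊛-congˡ : ∀ {f f′} g → (∀ m k → f m k ≡ f′ m k) → ∀ m k → (f ⊛ g) m k ≡ (f′ ⊛ g) m k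
  ⊛-congˡ g f≗f′ m k = sumTo-cong m (λ i → sumTo-cong k (λ j → cong (_* g (m ∸ i) (k ∸ j)) (f≗f′ i j)))

  ⊛-congʳ : ∀ f {g g′} → (∀ m k → g m k ≡ g′ m k) → ∀ m k → (f ⊛ g) m k ≡ (f ⊛ g′) m k
  ⊛-congʳ f g≗g′ m k = sumTo-cong m (λ i → sumTo-cong k (λ j → cong (f i j *_) (g≗g′ (m ∸ i) (k ∸ j))))

  ⊛-distribʳ : ∀ f g h m k → ((λ i j → f i j + g i j) ⊛ h) m k ≡ (f ⊛ h) m k + (g ⊛ h) m k
  ⊛-distribʳ f g h m k = ≡.trans
    (sumTo-cong m (λ i → ≡.trans (sumTo-cong k (λ j → *-distribʳ-+ (h (m ∸ i) (k ∸ j)) (f i j) (g i j))) (sumTo-+ k _ _)))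
    (sumTo-+ m _ _)

  monomial-⊛ : ∀ c a b f m k → (monomial c a b ⊛ f) m k ≡ c * shift a b f m k
  monomial-⊛ c a b f m k = begin
    sumTo m (λ i → sumTo k (λ j → monomial c a b i j * f (m ∸ i) (k ∸ j)))  ≡⟨ sumTo-cong m row ⟩
    sumTo m (λ i → if a ≡ᵇ i then inner i else + 0)                          ≡⟨ sumTo-delta a m inner ⟩
    (if a ≤ᵇ m then inner a else + 0)                                        ≡⟨ collapse ⟩
    c * shift a b f m k                                                      ∎
    where
    inner : ℕ → ℤ
    inner i = sumTo k (λ j → if b ≡ᵇ j then c * f (m ∸ i) (k ∸ j) else + 0)

    row : ∀ i → sumTo k (λ j → monomial c a b i j * f (m ∸ i) (k ∸ j)) ≡ (if a ≡ᵇ i then inner i else + 0)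
    row i with a ≡ᵇ i
    ... | false = sumTo-zero k
    ... | true  = sumTo-cong k (λ j → entry (b ≡ᵇ j) (f (m ∸ i) (k ∸ j)))
      where
      entry : ∀ β x → (if β then c else + 0) * x ≡ (if β then c * x else + 0)
      entry true  x = ≡.refl
      entry false x = ≡.refl

    collapse : (if a ≤ᵇ m then inner a else + 0) ≡ c * (if (a ≤ᵇ m) ∧ (b ≤ᵇ k) then f (m ∸ a) (k ∸ b) else + 0)
    collapse with a ≤ᵇ m
    ... | false = sym (*-zeroʳ c)
    ... | true  = ≡.trans (sumTo-delta b k _) guard
      where
      guard : (if b ≤ᵇ k then c * f (m ∸ a) (k ∸ b) else + 0) ≡ c * (if b ≤ᵇ k then f (m ∸ a) (k ∸ b) else + 0)
      guard with b ≤ᵇ k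
      ... | true  = ≡.refl
      ... | false = sym (*-zeroʳ c)

  ⊛-unit : ∀ f m k → (f ⊛ unit) m k ≡ f m k
  ⊛-unit f m k = begin
    sumTo m (λ i → sumTo k (λ j → f i j * unit (m ∸ i) (k ∸ j)))
      ≡⟨ sumTo-last m _ (λ i i<m → ≡.trans (sumTo-cong k (λ j → ≡.trans (cong (f i j *_) (unit-offᶻ (k ∸ j) (m<n⇒0<n∸m i<m)))
                                                                            (*-zeroʳ (f i j))))
                                             (sumTo-zero k)) ⟩
    sumTo k (λ j → f m j * unit (m ∸ m) (k ∸ j))
      ≡⟨ cong (λ d → sumTo k (λ j → f m j * unit d (k ∸ j))) (n∸n≡0 m) ⟩
    sumTo k (λ j → f m j * unit 0 (k ∸ j))
      ≡⟨ sumTo-last k _ (λ j j<k → ≡.trans (cong (f m j *_) (unit-offᵗ (m<n⇒0<n∸m j<k))) (*-zeroʳ (f m j))) ⟩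
    f m k * unit 0 (k ∸ k)
      ≡⟨ cong (λ d → f m k * unit 0 d) (n∸n≡0 k) ⟩
    f m k * + 1
      ≡⟨ *-identityʳ (f m k) ⟩
    f m k ∎
    where
    unit-offᶻ : ∀ {n} j → 0 < n → unit n j ≡ + 0
    unit-offᶻ j (s≤s _) = ≡.refl
    unit-offᵗ : ∀ {n} → 0 < n → unit 0 n ≡ + 0
    unit-offᵗ (s≤s _) = ≡.refl

  shift-cong : ∀ a b {f g} → (∀ m k → f m k ≡ g m k) → ∀ m k → shift a b f m k ≡ shift a b g m k
  shift-cong a b f≗g m k with (a ≤ᵇ m) ∧ (b ≤ᵇ k)
  ... | true  = f≗g (m ∸ a) (k ∸ b)
  ... | false = ≡.refl

  shift-behind : ∀ {a} b f {L} k → L < a → shift a b f L k ≡ + 0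
  shift-behind {a} b f {L} k L<a rewrite ≤ᵇ-false L<a = ≡.refl

  shift-zero : ∀ a b m k → shift a b (λ _ _ → + 0) m k ≡ + 0
  shift-zero a b m k with (a ≤ᵇ m) ∧ (b ≤ᵇ k)
  ... | true  = ≡.refl
  ... | false = ≡.refl

  shift-+ : ∀ a b f g m k → shift a b (λ i j → f i j + g i j) m k ≡ shift a b f m k + shift a b g m k
  shift-+ a b f g m k with (a ≤ᵇ m) ∧ (b ≤ᵇ k)
  ... | true  = ≡.refl
  ... | false = ≡.refl

  shift-* : ∀ a b r f m k → shift a b (λ i j → r * f i j) m k ≡ r * shift a b f m k
  shift-* a b r f m k with (a ≤ᵇ m) ∧ (b ≤ᵇ k)
  ... | true  = ≡.refl
  ... | false = sym (*-zeroʳ r)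

  shift-shift : ∀ a b a′ b′ f m k → shift a b (shift a′ b′ f) m k ≡ shift (a ℕ.+ a′) (b ℕ.+ b′) f m k
  shift-shift a b a′ b′ f m k
    rewrite ≤ᵇ-+ a a′ m | ≤ᵇ-+ b b′ k | ∸-+-assoc m a a′ | ∸-+-assoc k b b′
    with a ≤ᵇ m | b ≤ᵇ k | a′ ≤ᵇ m ∸ a
  ... | true  | true  | _     = ≡.refl
  ... | true  | false | true  = ≡.refl
  ... | true  | false | false = ≡.refl
  ... | false | _     | _     = ≡.refl

open Series

module LinearCombination where

  open import Data.Nat as ℕ using ()
  open import Data.Integer as ℤ using (+_; _+_; _*_; -_)
  open import Data.Integer.Properties using (+-identityʳ; +-identityˡ; *-zeroʳ; *-distribʳ-+; *-distribˡ-+;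
    *-assoc; +-assoc; neg-distribˡ-*; neg-distrib-+; +-inverseˡ; +-commutativeSemigroup)
  open import Algebra.Properties.CommutativeSemigroup +-commutativeSemigroup using (x∙yz≈y∙xz)
  open import Data.List using (List; []; _∷_; _++_; map)
  open import Data.Product using (_×_; _,_)
  open import Data.Product.Properties using (≡-dec)
  open import Relation.Binary using (DecidableEquality)
  open import Relation.Nullary using (yes; no)
  open import Relation.Binary.PropositionalEquality as ≡ using (cong; cong₂; sym)
  open ≡.≡-Reasoning

  -- c · z^a t^b · (series number s), written (c , s , a , b)
  Term : Set → Set
  Term S = ℤ × S × ℕ × ℕ

  module Evaluation {S : Set} (_≟ₛ_ : DecidableEquality S) (V : S → PowerSeries) where

    evalKey : S × ℕ × ℕ → PowerSeries
    evalKey (s , a , b) = shift a b (V s)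

    evalTerm : Term S → PowerSeries
    evalTerm (c , key) m k = c * evalKey key m k

    eval : List (Term S) → PowerSeries
    eval []       m k = + 0
    eval (t ∷ ts) m k = evalTerm t m k + eval ts m k

    monomials : S → List Monomial → List (Term S)
    monomials s = map (λ (c , a , b) → (c , s , a , b))

    ⊛-poly : ∀ s ms m k → (poly ms ⊛ V s) m k ≡ eval (monomials s ms) m k
    ⊛-poly s []                m k = ≡.trans (sumTo-cong m (λ i → sumTo-zero k)) (sumTo-zero m)
    ⊛-poly s ((c , a , b) ∷ ms) m k = begin
      (poly ((c , a , b) ∷ ms) ⊛ V s) m k
        ≡⟨ ⊛-congˡ (V s) (poly-∷ c a b ms) m k ⟩
      ((λ i j → monomial c a b i j + poly ms i j) ⊛ V s) m k
        ≡⟨ ⊛-distribʳ (monomial c a b) (poly ms) (V s) m k ⟩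
      (monomial c a b ⊛ V s) m k + (poly ms ⊛ V s) m k
        ≡⟨ cong₂ _+_ (monomial-⊛ c a b (V s) m k) (⊛-poly s ms m k) ⟩
      eval (monomials s ((c , a , b) ∷ ms)) m k ∎

    eval-++ : ∀ ts us m k → eval (ts ++ us) m k ≡ eval ts m k + eval us m k
    eval-++ []       us m k = sym (+-identityˡ (eval us m k))
    eval-++ (t ∷ ts) us m k = ≡.trans (cong (λ x → evalTerm t m k + x) (eval-++ ts us m k)) (sym (+-assoc (evalTerm t m k) _ _))

    negate : Term S → Term S
    negate (c , key) = (- c , key)

    eval-negate : ∀ ts m k → eval (map negate ts) m k ≡ - eval ts m k
    eval-negate []                   m k = ≡.refl
    eval-negate ((c , s , a , b) ∷ ts) m k = begin
      - c * shift a b (V s) m k + eval (map negate ts) m k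
        ≡⟨ cong₂ _+_ (sym (neg-distribˡ-* c _)) (eval-negate ts m k) ⟩
      - (c * shift a b (V s) m k) + - eval ts m k
        ≡⟨ neg-distrib-+ (c * shift a b (V s) m k) (eval ts m k) ⟨
      - (c * shift a b (V s) m k + eval ts m k) ∎

    scale : ℤ → ℕ → ℕ → Term S → Term S
    scale r a b (c , s , a′ , b′) = (r * c , s , a ℕ.+ a′ , b ℕ.+ b′)

    eval-scale : ∀ r a b ts m k → eval (map (scale r a b) ts) m k ≡ r * shift a b (eval ts) m k
    eval-scale r a b [] m k = sym (≡.trans (cong (r *_) (shift-zero a b m k)) (*-zeroʳ r))
    eval-scale r a b ((c , s , a′ , b′) ∷ ts) m k = begin
      r * c * shift (a ℕ.+ a′) (b ℕ.+ b′) (V s) m k + eval (map (scale r a b) ts) m k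
        ≡⟨ cong₂ _+_ (≡.trans (*-assoc r c _) (cong (r *_) (≡.trans (cong (c *_) (sym (shift-shift a b a′ b′ (V s) m k)))
                                                                       (sym (shift-* a b c (shift a′ b′ (V s)) m k)))))
                     (eval-scale r a b ts m k) ⟩
      r * shift a b (evalTerm (c , s , a′ , b′)) m k + r * shift a b (eval ts) m k
        ≡⟨ *-distribˡ-+ r _ _ ⟨
      r * (shift a b (evalTerm (c , s , a′ , b′)) m k + shift a b (eval ts) m k)
        ≡⟨ cong (r *_) (shift-+ a b (evalTerm (c , s , a′ , b′)) (eval ts) m k) ⟨
      r * shift a b (eval ((c , s , a′ , b′) ∷ ts)) m k ∎

    _≟ₖ_ : DecidableEquality (S × ℕ × ℕ)
    _≟ₖ_ = ≡-dec _≟ₛ_ (≡-dec ℕ._≟_ ℕ._≟_)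

    insert : Term S → List (Term S) → List (Term S)
    insert t [] = t ∷ []
    insert (c , key) ((c′ , key′) ∷ ts) with key ≟ₖ key′
    ... | no  _ = (c′ , key′) ∷ insert (c , key) ts
    ... | yes _ with c + c′ ℤ.≟ + 0
    ...   | yes _ = ts
    ...   | no  _ = (c + c′ , key′) ∷ ts

    normalise : List (Term S) → List (Term S)
    normalise []       = []
    normalise (t ∷ ts) = insert t (normalise ts)

    eval-insert : ∀ t ts m k → eval (insert t ts) m k ≡ evalTerm t m k + eval ts m k
    eval-insert t [] m k = ≡.refl
    eval-insert (c , key) ((c′ , key′) ∷ ts) m k with key ≟ₖ key′
    ... | no _ = begin
      evalTerm (c′ , key′) m k + eval (insert (c , key) ts) m k
        ≡⟨ cong (λ x → evalTerm (c′ , key′) m k + x) (eval-insert (c , key) ts m k) ⟩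
      evalTerm (c′ , key′) m k + (evalTerm (c , key) m k + eval ts m k)
        ≡⟨ x∙yz≈y∙xz (evalTerm (c′ , key′) m k) (evalTerm (c , key) m k) (eval ts m k) ⟩
      evalTerm (c , key) m k + (evalTerm (c′ , key′) m k + eval ts m k) ∎
    ... | yes ≡.refl with c + c′ ℤ.≟ + 0
    ...   | yes c+c′≡0 = sym (begin
      evalTerm (c , key) m k + (evalTerm (c′ , key) m k + eval ts m k)
        ≡⟨ +-assoc (evalTerm (c , key) m k) _ _ ⟨
      (evalTerm (c , key) m k + evalTerm (c′ , key) m k) + eval ts m k
        ≡⟨ cong (λ x → x + eval ts m k) (*-distribʳ-+ (evalKey key m k) c c′) ⟨
      (c + c′) * evalKey key m k + eval ts m k
        ≡⟨ cong (λ x → x * evalKey key m k + eval ts m k) c+c′≡0 ⟩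
      + 0 * evalKey key m k + eval ts m k
        ≡⟨ +-identityˡ (eval ts m k) ⟩
      eval ts m k ∎)
    ...   | no _ = ≡.trans (cong (λ x → x + eval ts m k) (*-distribʳ-+ (evalKey key m k) c c′))
                           (+-assoc (evalTerm (c , key) m k) (evalTerm (c′ , key) m k) (eval ts m k))

    eval-normalise : ∀ ts m k → eval (normalise ts) m k ≡ eval ts m k
    eval-normalise []       m k = ≡.refl
    eval-normalise (t ∷ ts) m k =
      ≡.trans (eval-insert t (normalise ts) m k) (cong (λ x → evalTerm t m k + x) (eval-normalise ts m k))

    eval-cancel : ∀ ts us → normalise (ts ++ map negate us) ≡ [] → ∀ m k → eval ts m k ≡ eval us m k
    eval-cancel ts us cancels m k = begin
      eval ts m k                                    ≡⟨ +-identityʳ (eval ts m k) ⟨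
      eval ts m k + + 0                              ≡⟨ cong (λ x → eval ts m k + x) (+-inverseˡ (eval us m k)) ⟨
      eval ts m k + (- eval us m k + eval us m k)    ≡⟨ +-assoc (eval ts m k) _ _ ⟨
      (eval ts m k + - eval us m k) + eval us m k    ≡⟨ cong (λ x → x + eval us m k) difference≡0 ⟩
      + 0 + eval us m k                              ≡⟨ +-identityˡ (eval us m k) ⟩
      eval us m k                                    ∎
      where
      difference≡0 : eval ts m k + - eval us m k ≡ + 0
      difference≡0 = begin
        eval ts m k + - eval us m k                  ≡⟨ cong (λ x → eval ts m k + x) (eval-negate us m k) ⟨
        eval ts m k + eval (map negate us) m k       ≡⟨ eval-++ ts (map negate us) m k ⟨
        eval (ts ++ map negate us) m k               ≡⟨ eval-normalise (ts ++ map negate us) m k ⟨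
        eval (normalise (ts ++ map negate us)) m k   ≡⟨ cong (λ vs → eval vs m k) cancels ⟩
        + 0                                          ∎

    combine : {R : Set} → (R → List (Term S)) → List (ℤ × R × ℕ × ℕ) → List (Term S)
    combine relation []                   = []
    combine relation ((r , p , a , b) ∷ ms) = map (scale r a b) (relation p) ++ combine relation ms

    eval-combine : {R : Set} (relation : R → List (Term S)) → (∀ p m k → eval (relation p) m k ≡ + 0) →
      ∀ ms m k → eval (combine relation ms) m k ≡ + 0
    eval-combine relation holds []                   m k = ≡.refl
    eval-combine relation holds ((r , p , a , b) ∷ ms) m k = begin
      eval (map (scale r a b) (relation p) ++ combine relation ms) m k
        ≡⟨ eval-++ (map (scale r a b) (relation p)) (combine relation ms) m k ⟩
      eval (map (scale r a b) (relation p)) m k + eval (combine relation ms) m k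
        ≡⟨ cong₂ _+_ (eval-scale r a b (relation p) m k) (eval-combine relation holds ms m k) ⟩
      r * shift a b (eval (relation p)) m k + + 0
        ≡⟨ cong (λ x → r * x + + 0) (≡.trans (shift-cong a b (holds p) m k) (shift-zero a b m k)) ⟩
      r * + 0 + + 0
        ≡⟨ cong (_+ + 0) (*-zeroʳ r) ⟩
      + 0 ∎

open LinearCombination

module Profiles where

  open import Data.Bool using (true; false; _∧_; if_then_else_)
  open import Data.Nat as ℕ using (zero; suc; _∸_; _≤_; _<_; _≤ᵇ_; s≤s)
  open import Data.Nat.Properties using (m≤n⇒∃[o]m+o≡n; m+[n∸m]≡n; m+n∸m≡n; m≤m+n; +-assoc; +-monoˡ-≤;
    +-monoʳ-<; ≤-trans; m≤n+m; <⇒≤; +-identityʳ; ≰⇒>; ≮⇒≥)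
  open import Data.Integer as ℤ using (+_; -[1+_]; _+_; _*_; -1ℤ)
  open import Data.Integer.Properties using (pos-+; pos-*)
  import Data.Integer.Properties
  open import Data.Integer.Tactic.RingSolver using (solve-∀)
  open import Data.Fin using (Fin; toℕ)
  open import Data.Fin.Properties using (toℕ≤pred[n])
  open import Data.List using (List; []; _∷_)
  open import Data.Product using (_,_)
  open import Relation.Binary using (DecidableEquality)
  open import Relation.Nullary using (yes; no)
  open import Relation.Binary.PropositionalEquality as ≡ using (cong; cong₂; sym)
  open ≡.≡-Reasoning

  -- which half of the region is the shorter one
  data Side : Set where
    lower upper : Side

  opposite : Side → Side
  opposite lower = upper
  opposite upper = lower

  oriented : Side → ℕ → ℕ → ℕ → ℕ
  oriented lower short long = T₁₂ short long
  oriented upper short long = T₁₂ long short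

  oriented-extend : ∀ s {a} b k → a ≤ 5 ℕ.+ b → oriented s a (6 ℕ.+ b) k ≡ oriented s a (5 ℕ.+ b) k ℕ.+ timesT (oriented s a b) k
  oriented-extend lower b k = T₁₂-upper b k
  oriented-extend upper b k = T₁₂-lower b k

  oriented-short : ∀ s {a c} k → a ≤ 5 → c ≤ 5 → oriented s a c k ≡ T₁₂ 0 0 k
  oriented-short lower k a≤5 c≤5 = T₁₂-short k a≤5 c≤5
  oriented-short upper k a≤5 c≤5 = T₁₂-short k c≤5 a≤5

  -- The last column of the longer half carries no square, or one that shortens that half by six,
  -- to n − e; no square fits there when n < e.
  oriented-step : ∀ s {d e} n k → d ℕ.+ e ≡ 5 →
    oriented s n (suc (d ℕ.+ n)) k ≡ oriented s n (d ℕ.+ n) k ℕ.+ timesT (λ j → if e ≤ᵇ n then oriented s n (n ∸ e) j else 0) k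
  oriented-step s {d} {e} n k d+e≡5 with e ℕ.≤? n
  ... | yes e≤n with m≤n⇒∃[o]m+o≡n e≤n
  ...   | p , ≡.refl
    rewrite ≡.trans (sym (+-assoc d e p)) (cong (ℕ._+ p) d+e≡5) | ≤ᵇ-true (m≤m+n e p) | m+n∸m≡n e p
    = oriented-extend s p k (+-monoˡ-≤ p (≡.subst (e ≤_) d+e≡5 (m≤n+m e d)))
  oriented-step s {d} {e} n k d+e≡5 | no e≰n rewrite ≤ᵇ-false (≰⇒> e≰n) = begin
    oriented s n (suc (d ℕ.+ n)) k    ≡⟨ oriented-short s k n≤5 d+n<5 ⟩
    T₁₂ 0 0 k                        ≡⟨ oriented-short s k n≤5 (<⇒≤ d+n<5) ⟨
    oriented s n (d ℕ.+ n) k          ≡⟨ +-identityʳ _ ⟨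
    oriented s n (d ℕ.+ n) k ℕ.+ 0    ≡⟨ cong (oriented s n (d ℕ.+ n) k ℕ.+_) (timesT-zero k) ⟨
    oriented s n (d ℕ.+ n) k ℕ.+ timesT (λ _ → 0) k ∎
    where
    d+n<5 : d ℕ.+ n < 5
    d+n<5 = ≡.subst (d ℕ.+ n <_) d+e≡5 (+-monoʳ-< d (≰⇒> e≰n))
    n≤5 : n ≤ 5
    n≤5 = ≤-trans (m≤n+m n d) (<⇒≤ d+n<5)
    timesT-zero : ∀ k → timesT (λ _ → 0) k ≡ 0
    timesT-zero zero    = ≡.refl
    timesT-zero (suc k) = ≡.refl

  data State : Set where
    one : State
    lag : ℕ → ℕ → State

  _≟ₛ_ : DecidableEquality State
  one       ≟ₛ one         = yes ≡.refl
  one       ≟ₛ lag _ _     = no λ ()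
  lag _ _   ≟ₛ one         = no λ ()
  lag d₀ d₆ ≟ₛ lag d₀′ d₆′ with d₀ ℕ.≟ d₀′ | d₆ ℕ.≟ d₆′
  ... | yes ≡.refl | yes ≡.refl = yes ≡.refl
  ... | no  d₀≢d₀′ | _          = no λ { ≡.refl → d₀≢d₀′ ≡.refl }
  ... | yes _      | no  d₆≢d₆′ = no λ { ≡.refl → d₆≢d₆′ ≡.refl }

  -- V (lag d₀ d₆) = Σ T₁₂(L − d₀, L − d₆, k) z^L t^k over L ≥ d₀, d₆: the lower and upper halves fall
  -- short of the length L by d₀ and d₆.  Only d₀ = 0 or d₆ = 0 occur, and V (lag 0 0) is F₁₂.
  V : State → PowerSeries
  V one          = unit
  V (lag d₀ d₆) L k = if (d₀ ≤ᵇ L) ∧ (d₆ ≤ᵇ L) then + T₁₂ (L ∸ d₀) (L ∸ d₆) k else + 0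

  lagged : Side → ℕ → State
  lagged lower d = lag d 0
  lagged upper d = lag 0 d

  V-lagged : ∀ s d L k → V (lagged s d) L k ≡ (if d ≤ᵇ L then + oriented s (L ∸ d) L k else + 0)
  V-lagged lower d L k with d ≤ᵇ L
  ... | true  = ≡.refl
  ... | false = ≡.refl
  V-lagged upper d L k = ≡.refl

  oriented-opposite : ∀ s a c k → oriented (opposite s) a c k ≡ oriented s c a k
  oriented-opposite lower a c k = ≡.refl
  oriented-opposite upper a c k = ≡.refl

  V-lagged-ahead : ∀ s d n k → V (lagged s d) (d ℕ.+ n) k ≡ + oriented s n (d ℕ.+ n) k
  V-lagged-ahead s d n k rewrite V-lagged s d (d ℕ.+ n) k | ≤ᵇ-true (m≤m+n d n) | m+n∸m≡n d n = ≡.refl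

  V-lagged-behind : ∀ s {d L} k → L < d → V (lagged s d) L k ≡ + 0
  V-lagged-behind s {d} {L} k L<d rewrite V-lagged s d L k | ≤ᵇ-false L<d = ≡.refl

  step-equation : ∀ s {d e} → d ℕ.+ e ≡ 5 → ∀ L k →
    V (lagged s (suc d)) L k ≡ shift 1 0 (V (lagged s d)) L k + shift (suc d) 1 (V (lagged (opposite s) e)) L k
  step-equation s {d} {e} d+e≡5 L k with L ℕ.≤? d
  ... | yes L≤d = begin
    V (lagged s (suc d)) L k                ≡⟨ V-lagged-behind s k (s≤s L≤d) ⟩
    + 0                                     ≡⟨ cong₂ _+_ (shortened L L≤d) (shift-behind 1 (V (lagged (opposite s) e)) k (s≤s L≤d)) ⟨
    shift 1 0 (V (lagged s d)) L k + shift (suc d) 1 (V (lagged (opposite s) e)) L k ∎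
    where
    shortened : ∀ L → L ≤ d → shift 1 0 (V (lagged s d)) L k ≡ + 0
    shortened zero    _   = ≡.refl
    shortened (suc L) L<d = V-lagged-behind s k L<d
  ... | no L≰d with m≤n⇒∃[o]m+o≡n (≰⇒> L≰d)
  ...   | n , ≡.refl = begin
    V (lagged s (suc d)) (suc (d ℕ.+ n)) k
      ≡⟨ V-lagged-ahead s (suc d) n k ⟩
    + oriented s n (suc (d ℕ.+ n)) k
      ≡⟨ cong +_ (oriented-step s n k d+e≡5) ⟩
    + (oriented s n (d ℕ.+ n) k ℕ.+ timesT lastSquare k)
      ≡⟨ pos-+ (oriented s n (d ℕ.+ n) k) (timesT lastSquare k) ⟩
    + oriented s n (d ℕ.+ n) k + + timesT lastSquare k
      ≡⟨ cong₂ _+_ (V-lagged-ahead s d n k) (last-column k) ⟨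
    shift 1 0 (V (lagged s d)) (suc (d ℕ.+ n)) k + shift (suc d) 1 (V (lagged (opposite s) e)) (suc (d ℕ.+ n)) k ∎
    where
    lastSquare : ℕ → ℕ
    lastSquare j = if e ≤ᵇ n then oriented s n (n ∸ e) j else 0

    last-column : ∀ k → shift (suc d) 1 (V (lagged (opposite s) e)) (suc (d ℕ.+ n)) k ≡ + timesT lastSquare k
    last-column k rewrite ≤ᵇ-true (s≤s (m≤m+n d n)) | m+n∸m≡n d n with k
    ... | zero  = ≡.refl
    ... | suc j rewrite V-lagged (opposite s) e n j | oriented-opposite s (n ∸ e) n j with e ≤ᵇ n
    ...   | true  = ≡.refl
    ...   | false = ≡.refl

  pos-level : ∀ {x} y z w → x ≡ (y ℕ.+ z) ℕ.+ 5 ℕ.* w → + x ≡ ((+ y + + z) + + 5 * + w) + + 0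
  pos-level {x} y z w eq = begin
    + x                                  ≡⟨ cong +_ eq ⟩
    + ((y ℕ.+ z) ℕ.+ 5 ℕ.* w)            ≡⟨ pos-+ (y ℕ.+ z) (5 ℕ.* w) ⟩
    + (y ℕ.+ z) + + (5 ℕ.* w)            ≡⟨ cong₂ _+_ (pos-+ y z) (pos-* 5 w) ⟩
    (+ y + + z) + + 5 * + w              ≡⟨ Data.Integer.Properties.+-identityʳ _ ⟨
    ((+ y + + z) + + 5 * + w) + + 0      ∎

  level-equation : ∀ L k →
    V (lag 0 0) L k ≡ ((V (lag 1 0) L k + shift 0 1 (V (lag 6 0)) L k) + + 5 * shift 6 1 (V (lag 0 0)) L k) + unit L k
  level-equation zero zero    = ≡.refl
  level-equation zero (suc k) = ≡.refl
  level-equation (suc L) k with L ℕ.<? 5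
  ... | yes L<5 = begin
    + T₁₂ (suc L) (suc L) k
      ≡⟨ cong +_ (≡.trans (T₁₂-short k L<5 L<5) (sym (T₁₂-short k (<⇒≤ L<5) L<5))) ⟩
    + T₁₂ L (suc L) k
      ≡⟨ pad (+ T₁₂ L (suc L) k) ⟩
    ((+ T₁₂ L (suc L) k + + 0) + + 5 * + 0) + + 0
      ≡⟨ cong₂ (λ x y → ((+ T₁₂ L (suc L) k + x) + + 5 * y) + + 0) (upper-block k) (shift-behind 1 (V (lag 0 0)) k (s≤s L<5)) ⟨
    ((+ T₁₂ L (suc L) k + shift 0 1 (V (lag 6 0)) (suc L) k) + + 5 * shift 6 1 (V (lag 0 0)) (suc L) k) + + 0 ∎
    where
    pad : ∀ x → x ≡ ((x + + 0) + + 5 * + 0) + + 0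
    pad = solve-∀
    upper-block : ∀ k → shift 0 1 (V (lag 6 0)) (suc L) k ≡ + 0
    upper-block zero    = ≡.refl
    upper-block (suc k) = V-lagged-behind lower k (s≤s L<5)
  ... | no L≮5 with m≤n⇒∃[o]m+o≡n (≮⇒≥ L≮5)
  ...   | n , ≡.refl with k
  ...     | zero  = pos-level (T₁₂ (5 ℕ.+ n) (6 ℕ.+ n) 0) 0 0 (T₁₂-level n 0)
  ...     | suc j = pos-level (T₁₂ (5 ℕ.+ n) (6 ℕ.+ n) (suc j)) (T₁₂ n (6 ℕ.+ n) j) (T₁₂ n n j) (T₁₂-level n (suc j))

  data Recurrence : Set where
    level : Recurrence
    step  : Side → Fin 6 → Recurrence

  -- level:     V₀₀ = V₁₀ + t V₆₀ + 5 z⁶ t V₀₀ + 1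
  -- step s i:  V(s, d + 1) = z V(s, d) + z^(d+1) t V(opposite s, 5 − d),  where d = toℕ i
  relation : Recurrence → List (Term State)
  relation level =
    (+ 1 , lag 0 0 , 0 , 0) ∷ (-1ℤ , lag 1 0 , 0 , 0) ∷ (-1ℤ , lag 6 0 , 0 , 1) ∷ (-[1+ 4 ] , lag 0 0 , 6 , 1) ∷ (-1ℤ , one , 0 , 0) ∷ []
  relation (step s i) =
    (+ 1 , lagged s (suc d) , 0 , 0) ∷ (-1ℤ , lagged s d , 1 , 0) ∷ (-1ℤ , lagged (opposite s) (5 ∸ d) , suc d , 1) ∷ []
    where d = toℕ i

  open Evaluation _≟ₛ_ V

  relation-holds : ∀ r L k → eval (relation r) L k ≡ + 0
  relation-holds level      L k =
    balance₅ (V (lag 0 0) L k) (V (lag 1 0) L k) (shift 0 1 (V (lag 6 0)) L k) (shift 6 1 (V (lag 0 0)) L k) (unit L k) (level-equation L k)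
    where
    balance₅ : ∀ x y z w u → x ≡ ((y + z) + + 5 * w) + u →
      + 1 * x + (-1ℤ * y + (-1ℤ * z + (-[1+ 4 ] * w + (-1ℤ * u + + 0)))) ≡ + 0
    balance₅ _ y z w u ≡.refl = identity y z w u
      where
      identity : ∀ y z w u → + 1 * (((y + z) + + 5 * w) + u) + (-1ℤ * y + (-1ℤ * z + (-[1+ 4 ] * w + (-1ℤ * u + + 0)))) ≡ + 0
      identity = solve-∀
  relation-holds (step s i) L k =
    balance₃ (V (lagged s (suc (toℕ i))) L k) (shift 1 0 (V (lagged s (toℕ i))) L k)
             (shift (suc (toℕ i)) 1 (V (lagged (opposite s) (5 ∸ toℕ i))) L k)
             (step-equation s (m+[n∸m]≡n (toℕ≤pred[n] i)) L k)
    where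
    balance₃ : ∀ x y z → x ≡ y + z → + 1 * x + (-1ℤ * y + (-1ℤ * z + + 0)) ≡ + 0
    balance₃ _ y z ≡.refl = identity y z
      where
      identity : ∀ y z → + 1 * (y + z) + (-1ℤ * y + (-1ℤ * z + + 0)) ≡ + 0
      identity = solve-∀

open Profiles

open import Data.Integer using (+_; -[1+_]; _+_)
open import Data.Integer.Properties using (+-identityʳ)
open import Data.Fin using (#_)
open import Data.List using (List; []; _∷_; _++_; map)
open import Data.Product using (_×_; _,_)
open import Relation.Binary.PropositionalEquality as ≡ using (cong; cong₂; sym)

open Evaluation _≟ₛ_ V

-- (r , p , a , b) stands for r z^a t^b times recurrence p
multipliers : List (ℤ × Recurrence × ℕ × ℕ)
multipliers =
    (+ 1 , level , 0 , 0)
  ∷ (-[1+ 0 ] , level , 3 , 1)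
  ∷ (-[1+ 0 ] , level , 4 , 1)
  ∷ (-[1+ 0 ] , level , 5 , 1)
  ∷ (-[1+ 1 ] , level , 6 , 2)
  ∷ (-[1+ 0 ] , level , 7 , 2)
  ∷ (+ 2 , level , 9 , 3)
  ∷ (+ 2 , level , 10 , 3)
  ∷ (+ 1 , level , 12 , 4)
  ∷ (-[1+ 0 ] , level , 15 , 5)
  ∷ (+ 1 , step lower (# 0) , 0 , 0)
  ∷ (-[1+ 0 ] , step lower (# 0) , 3 , 1)
  ∷ (-[1+ 0 ] , step lower (# 0) , 4 , 1)
  ∷ (-[1+ 0 ] , step lower (# 0) , 6 , 2)
  ∷ (+ 1 , step lower (# 0) , 9 , 3)
  ∷ (+ 1 , step lower (# 1) , 4 , 1)
  ∷ (+ 1 , step lower (# 1) , 6 , 2)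
  ∷ (-[1+ 0 ] , step lower (# 1) , 9 , 3)
  ∷ (+ 1 , step lower (# 2) , 3 , 1)
  ∷ (+ 1 , step lower (# 3) , 2 , 1)
  ∷ (-[1+ 0 ] , step lower (# 3) , 5 , 2)
  ∷ (+ 1 , step lower (# 4) , 1 , 1)
  ∷ (-[1+ 0 ] , step lower (# 4) , 4 , 2)
  ∷ (-[1+ 0 ] , step lower (# 4) , 5 , 2)
  ∷ (-[1+ 0 ] , step lower (# 4) , 7 , 3)
  ∷ (+ 1 , step lower (# 4) , 10 , 4)
  ∷ (+ 1 , step lower (# 5) , 0 , 1)
  ∷ (-[1+ 0 ] , step lower (# 5) , 3 , 2)
  ∷ (-[1+ 0 ] , step lower (# 5) , 4 , 2)
  ∷ (-[1+ 0 ] , step lower (# 5) , 5 , 2)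
  ∷ (-[1+ 1 ] , step lower (# 5) , 6 , 3)
  ∷ (-[1+ 0 ] , step lower (# 5) , 7 , 3)
  ∷ (+ 2 , step lower (# 5) , 9 , 4)
  ∷ (+ 2 , step lower (# 5) , 10 , 4)
  ∷ (+ 1 , step lower (# 5) , 12 , 5)
  ∷ (-[1+ 0 ] , step lower (# 5) , 15 , 6)
  ∷ (+ 1 , step upper (# 0) , 5 , 1)
  ∷ (+ 1 , step upper (# 0) , 6 , 2)
  ∷ (+ 1 , step upper (# 0) , 7 , 2)
  ∷ (-[1+ 0 ] , step upper (# 0) , 9 , 3)
  ∷ (-[1+ 1 ] , step upper (# 0) , 10 , 3)
  ∷ (-[1+ 0 ] , step upper (# 0) , 12 , 4)
  ∷ (+ 1 , step upper (# 0) , 15 , 5)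
  ∷ (+ 1 , step upper (# 1) , 4 , 1)
  ∷ (+ 1 , step upper (# 1) , 6 , 2)
  ∷ (-[1+ 0 ] , step upper (# 1) , 9 , 3)
  ∷ (+ 1 , step upper (# 2) , 3 , 1)
  ∷ (+ 1 , step upper (# 3) , 2 , 1)
  ∷ (-[1+ 0 ] , step upper (# 3) , 5 , 2)
  ∷ (+ 1 , step upper (# 4) , 1 , 1)
  ∷ (-[1+ 0 ] , step upper (# 4) , 4 , 2)
  ∷ (-[1+ 0 ] , step upper (# 4) , 5 , 2)
  ∷ (-[1+ 0 ] , step upper (# 4) , 7 , 3)
  ∷ (+ 1 , step upper (# 4) , 10 , 4)
  ∷ []

certificate : normalise (monomials (lag 0 0) D ++ map negate (monomials one N ++ combine relation multipliers)) ≡ []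
certificate = ≡.refl

mainTheorem13 : ∀ (m k : ℕ) → (poly D ⊛ F₁₂) m k ≡ poly N m k
mainTheorem13 m k = begin
  (poly D ⊛ F₁₂) m k
    ≡⟨ ⊛-congʳ (poly D) (λ m k → cong +_ (T-count≡T₁₂ m k)) m k ⟩
  (poly D ⊛ V (lag 0 0)) m k
    ≡⟨ ⊛-poly (lag 0 0) D m k ⟩
  eval (monomials (lag 0 0) D) m k
    ≡⟨ eval-cancel (monomials (lag 0 0) D) (monomials one N ++ combine relation multipliers) certificate m k ⟩
  eval (monomials one N ++ combine relation multipliers) m k
    ≡⟨ eval-++ (monomials one N) (combine relation multipliers) m k ⟩
  eval (monomials one N) m k + eval (combine relation multipliers) m k
    ≡⟨ cong₂ _+_ (⊛-poly one N m k) (sym (eval-combine relation relation-holds multipliers m k)) ⟨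
  (poly N ⊛ unit) m k + + 0
    ≡⟨ +-identityʳ _ ⟩
  (poly N ⊛ unit) m k
    ≡⟨ ⊛-unit (poly N) m k ⟩
  poly N m k ∎
  where open ≡.≡-Reasoning
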